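{- Let $p$ be an odd prime. Then $$\sum_{k=0}^{p-1}\frac{(\frac k3)}{(-4)^k}\binom{2k}k\equiv\frac{(\frac{ -1}p)-(\frac 3p)}2\pmod p.$$
   Context: $\left(\frac k3\right)$ is the Legendre symbol modulo $3$ and $\left(\frac{\cdot}p\right)$ the Legendre symbol modulo $p$ (with $(\frac 3p)=0$ if $p=3$). Congruences between rationals with denominators prime to $p$ are understood in the ring of such rationals. -}

module Defs where

open import Data.Nat as ℕ using (ℕ; zero; suc)
open import Data.Nat.Combinatorics using (_C_)
open import Data.Integer as ℤ using (ℤ; +_; -[1+_])
open import Data.Integer.Divisibility.Signed using (_∣_; _∣?_)
open import Data.Rational as ℚ using (ℚ; 0ℚ; 1ℚ; _/_; ↥_; ↧ₙ_)
open import Data.List using (List; upTo; foldr; map)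
open import Data.List.Relation.Unary.Any using (Any; any?)
open import Data.Product using (_×_)
open import Relation.Nullary using (¬_; yes; no)

QR : ℕ → ℤ → Set
QR p a = Any (λ x → (+ p) ∣ ((+ x) ℤ.* (+ x) ℤ.- a)) (upTo p)

legendre : ℤ → ℕ → ℤ
legendre a p with (+ p) ∣? a
... | yes _ = + 0
... | no _ with any? (λ x → (+ p) ∣? ((+ x) ℤ.* (+ x) ℤ.- a)) (upTo p)
...   | yes _ = + 1
...   | no _ = -[1+ 0 ]

_^ℚ_ : ℚ → ℕ → ℚ
q ^ℚ zero = 1ℚ
q ^ℚ suc n = q ℚ.* (q ^ℚ n)

sumℚ : ℕ → (ℕ → ℚ) → ℚ
sumℚ n f = foldr (λ k acc → f k ℚ.+ acc) 0ℚ (upTo n)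

-- congruence a ≡ b (mod p) in the ring of rationals with denominators prime to p
-- (ℚ is kept in lowest terms, so ↥ / ↧ₙ are the reduced numerator / denominator)
_≡_[modℚ_] : ℚ → ℚ → ℕ → Set
a ≡ b [modℚ p ] =
  ¬ ((+ p) ∣ (+ (↧ₙ a))) × ¬ ((+ p) ∣ (+ (↧ₙ b))) × ((+ p) ∣ (↥ (a ℚ.- b)))

ℤ→ℚ : ℤ → ℚ
ℤ→ℚ z = z / 1

{-# OPTIONS --safe #-}
module Submission where

-- Write p = 2n + 1 and χ = (·/3). As -1/4 ≡ -n², the k-th summand is χ(k) C(2k,k)(-1/4)^k
-- ≡ χ(k) C(-1/2,k) ≡ χ(k) C(n,k) for k < p, so the sum is ≡ Σₖ χ(k) C(n,k). Let θ satisfy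
-- θ² = θ - 1 (a primitive sixth root of unity) and ω = θ². Then χ(k) is the θ-coordinate of ωᵏ
-- and 1 + ω = θ, so Σₖ χ(k) C(n,k) is the θ-coordinate of θⁿ and depends only on n mod 6.
-- On the other side, Euler's criterion (from Fermat and Wilson) gives (-1/p) ≡ (-1)ⁿ and
-- (3/p) ≡ 3ⁿ, and 3ⁿ mod p is read off from the Frobenius congruence (1 + θ)ᵖ ≡ 1 + θᵖ together
-- with (1 + θ)² = 3θ. Comparing the six residue classes of n gives 2 Σₖ χ(k) C(n,k) ≡ (-1/p) - (3/p);
-- halving modulo p is multiplication by -n.

-- An anonymous module, so that the integer operators opened here do not clash with the
-- natural-number _*_ opened for the statement at the end.
module _ where

  open import Data.Empty using (⊥-elim)
  open import Data.Integer as ℤ using (ℤ; +_; -[1+_]; _+_; _*_; _-_; -_; _^_; 0ℤ; 1ℤ; -1ℤ)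
  open import Data.Integer.DivMod using (_%ℕ_; _/ℕ_; n%ℕd<d; a≡a%ℕn+[a/ℕn]*n)
  open import Data.Integer.Divisibility.Signed as ℤ using (_∣_; _∣?_; ∣⇒∣ᵤ; ∣ᵤ⇒∣)
  import Data.Integer.Properties as ℤ
  open import Data.Integer.Tactic.RingSolver using (solve-∀)
  open import Data.List using (List; []; _∷_; _∷ʳ_; length; foldr; applyUpTo; upTo)
  open import Data.List.Membership.Propositional using (_∈_; _∉_)
  open import Data.List.Membership.Propositional.Properties using (∈-applyUpTo⁺; ∈-applyUpTo⁻)
  open import Data.List.Properties using (applyUpTo-∷ʳ; length-applyUpTo; length-removeAt′)
  open import Data.List.Relation.Unary.All as All using (All; []; _∷_)
  import Data.List.Relation.Unary.All.Properties as Allₚ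
  open import Data.List.Relation.Unary.AllPairs as AllPairs using ([]; _∷_)
  open import Data.List.Relation.Unary.Any as Any using (here; there; _─_; any?)
  import Data.List.Relation.Unary.Any.Properties as Anyₚ
  open import Data.List.Relation.Unary.Unique.Propositional using (Unique)
  open import Data.List.Relation.Unary.Unique.Propositional.Properties using (applyUpTo⁺₁)
  open import Data.Nat as ℕ using (ℕ; zero; suc; _<_; _≤_; z≤n; s≤s; NonZero)
  open import Data.Nat.Combinatorics using (_C_; nCk+nC[k+1]≡[n+1]C[k+1]; k>n⇒nCk≡0; nC1≡n; nCn≡1; nCk≡nC[n∸k])
  open import Data.Nat.Coprimality using (recompute)
  open import Data.Nat.Divisibility as ℕ using (divides)
  open import Data.Nat.ListAction using (product)
  open import Data.Nat.ListAction.Properties using (product-++)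
  open import Data.Nat.Primality using (Prime; euclidsLemma; ¬prime[1]; prime⇒irreducible)
  import Data.Nat.Properties as ℕ
  open import Algebra.Properties.CommutativeSemigroup ℕ.*-commutativeSemigroup using (x∙yz≈y∙xz)
  open import Data.Nat.Tactic.RingSolver as ℕ-Solver using ()
  open import Data.Product using (∃-syntax; _×_; _,_; proj₁; proj₂)
  open import Data.Rational as ℚ using (ℚ; mkℚ; 0ℚ; _/_; toℚᵘ)
  open import Data.Rational.Properties
    using (toℚᵘ-fromℚᵘ; toℚᵘ-homo-+; toℚᵘ-homo-*; toℚᵘ-homo‿-; ↥ᵘ-toℚᵘ; ↧ᵘ-toℚᵘ)
  open import Data.Rational.Unnormalised as ℚᵘ using (ℚᵘ; mkℚᵘ; *≡*; _≃_)
    renaming (↥_ to ↥ᵘ_; ↧_ to ↧ᵘ_)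
  import Data.Rational.Unnormalised.Properties as ℚᵘ
  open import Data.Sum using (_⊎_; inj₁; inj₂; [_,_]′)
  open import Defs using (QR; legendre; _^ℚ_; sumℚ; _≡_[modℚ_])
  open import Function using (_∘_)
  open import Level using (0ℓ)
  open import Relation.Binary.Bundles using (Setoid)
  open import Relation.Binary.Definitions using (tri<; tri≈; tri>)
  open import Relation.Binary.PropositionalEquality
    using (_≡_; _≢_; refl; sym; trans; cong; cong₂; subst; module ≡-Reasoning)
  open import Relation.Binary.Structures using (IsEquivalence)
  open import Relation.Nullary using (¬_; yes; no; Dec)

  -- Congruences of integers modulo p

  infix 4 _≡_[mod_]
  record _≡_[mod_] (a b : ℤ) (p : ℕ) : Set where
    constructor from-∣
    field to-∣ : + p ∣ a - b
  open _≡_[mod_] public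

  module _ {p : ℕ} where

    ∣-via-≡ : ∀ {a b} → a ≡ b → + p ∣ b → + p ∣ a
    ∣-via-≡ refl d = d

    ≡⇒≡-mod : ∀ {a b} → a ≡ b → a ≡ b [mod p ]
    ≡⇒≡-mod {a} refl = from-∣ (∣-via-≡ (ℤ.+-inverseʳ a) (ℤ.divides 0ℤ refl))

    ≡-mod-sym : ∀ {a b} → a ≡ b [mod p ] → b ≡ a [mod p ]
    ≡-mod-sym {a} {b} (from-∣ d) = from-∣ (∣-via-≡ (flip a b) (ℤ.∣m⇒∣-m d))
      where flip : ∀ a b → b - a ≡ - (a - b)
            flip = solve-∀

    ≡-mod-trans : ∀ {a b c} → a ≡ b [mod p ] → b ≡ c [mod p ] → a ≡ c [mod p ]
    ≡-mod-trans {a} {b} {c} (from-∣ d) (from-∣ e) = from-∣ (∣-via-≡ (split a b c) (ℤ.∣m∣n⇒∣m+n d e))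
      where split : ∀ a b c → a - c ≡ (a - b) + (b - c)
            split = solve-∀

    ≡-mod-isEquivalence : IsEquivalence (λ a b → a ≡ b [mod p ])
    ≡-mod-isEquivalence = record
      { refl = ≡⇒≡-mod refl ; sym = ≡-mod-sym ; trans = ≡-mod-trans }

    +-cong-mod : ∀ {a b c d} → a ≡ b [mod p ] → c ≡ d [mod p ] → a + c ≡ b + d [mod p ]
    +-cong-mod {a} {b} {c} {d} (from-∣ x) (from-∣ y) = from-∣ (∣-via-≡ (regroup a b c d) (ℤ.∣m∣n⇒∣m+n x y))
      where regroup : ∀ a b c d → (a + c) - (b + d) ≡ (a - b) + (c - d)
            regroup = solve-∀

    -‿cong-mod : ∀ {a b} → a ≡ b [mod p ] → - a ≡ - b [mod p ]
    -‿cong-mod {a} {b} (from-∣ x) = from-∣ (∣-via-≡ (regroup a b) (ℤ.∣m⇒∣-m x))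
      where regroup : ∀ a b → - a - - b ≡ - (a - b)
            regroup = solve-∀

    -cong-mod : ∀ {a b c d} → a ≡ b [mod p ] → c ≡ d [mod p ] → a - c ≡ b - d [mod p ]
    -cong-mod x y = +-cong-mod x (-‿cong-mod y)

    *-cong-mod : ∀ {a b c d} → a ≡ b [mod p ] → c ≡ d [mod p ] → a * c ≡ b * d [mod p ]
    *-cong-mod {a} {b} {c} {d} (from-∣ x) (from-∣ y) =
      from-∣ (∣-via-≡ (regroup a b c d) (ℤ.∣m∣n⇒∣m+n (ℤ.∣m⇒∣m*n c x) (ℤ.∣n⇒∣m*n b y)))
      where regroup : ∀ a b c d → a * c - b * d ≡ (a - b) * c + b * (c - d)
            regroup = solve-∀

    +-congˡ-mod : ∀ a {b c} → b ≡ c [mod p ] → a + b ≡ a + c [mod p ]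
    +-congˡ-mod a = +-cong-mod (≡⇒≡-mod {a} refl)

    *-congˡ-mod : ∀ a {b c} → b ≡ c [mod p ] → a * b ≡ a * c [mod p ]
    *-congˡ-mod a = *-cong-mod (≡⇒≡-mod {a} refl)

    *-congʳ-mod : ∀ a {b c} → b ≡ c [mod p ] → b * a ≡ c * a [mod p ]
    *-congʳ-mod a b≡c = *-cong-mod b≡c (≡⇒≡-mod {a} refl)

    ^-cong-mod : ∀ {a b} n → a ≡ b [mod p ] → a ^ n ≡ b ^ n [mod p ]
    ^-cong-mod zero    _ = ≡⇒≡-mod refl
    ^-cong-mod (suc n) x = *-cong-mod x (^-cong-mod n x)

    ∣⇒≡0-mod : ∀ {a} → + p ∣ a → a ≡ 0ℤ [mod p ]
    ∣⇒≡0-mod {a} d = from-∣ (∣-via-≡ (ℤ.+-identityʳ a) d)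

    ≡0-mod⇒∣ : ∀ {a} → a ≡ 0ℤ [mod p ] → + p ∣ a
    ≡0-mod⇒∣ {a} (from-∣ d) = ∣-via-≡ (sym (ℤ.+-identityʳ a)) d

  ≡-mod-setoid : ℕ → Setoid 0ℓ 0ℓ
  ≡-mod-setoid p = record { isEquivalence = ≡-mod-isEquivalence {p} }

  module ≡-mod-Reasoning (p : ℕ) where
    open import Relation.Binary.Reasoning.Setoid (≡-mod-setoid p) public

  module _ {p : ℕ} (p-prime : Prime p) where

    prime-∣-* : ∀ a b → + p ∣ a * b → + p ∣ a ⊎ + p ∣ b
    prime-∣-* a b d with euclidsLemma ℤ.∣ a ∣ ℤ.∣ b ∣ p-prime (subst (p ℕ.∣_) (ℤ.abs-* a b) (∣⇒∣ᵤ d))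
    ... | inj₁ x = inj₁ (∣ᵤ⇒∣ x)
    ... | inj₂ y = inj₂ (∣ᵤ⇒∣ y)

    prime-∤-* : ∀ {a b} → ¬ + p ∣ a → ¬ + p ∣ b → ¬ + p ∣ a * b
    prime-∤-* {a} {b} ∤a ∤b d with prime-∣-* a b d
    ... | inj₁ x = ∤a x
    ... | inj₂ y = ∤b y

    prime-∣-cancelˡ : ∀ c {a} → ¬ + p ∣ c → + p ∣ c * a → + p ∣ a
    prime-∣-cancelˡ c {a} ∤c d with prime-∣-* c a d
    ... | inj₁ x = ⊥-elim (∤c x)
    ... | inj₂ y = y

    prime-∣-^ : ∀ a n → + p ∣ a ^ suc n → + p ∣ a
    prime-∣-^ a zero    d = ∣-via-≡ (sym (ℤ.*-identityʳ a)) d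
    prime-∣-^ a (suc n) d = [ (λ p∣a → p∣a) , prime-∣-^ a n ]′ (prime-∣-* a (a ^ suc n) d)

    *-cancelˡ-mod : ∀ c {a b} → ¬ + p ∣ c → c * a ≡ c * b [mod p ] → a ≡ b [mod p ]
    *-cancelˡ-mod c {a} {b} ∤c (from-∣ d) = from-∣ (prime-∣-cancelˡ c ∤c (∣-via-≡ (factor c a b) d))
      where factor : ∀ c a b → c * (a - b) ≡ c * a - c * b
            factor = solve-∀

  ∤-between : ∀ {p m} → 0 < m → m < p → ¬ + p ∣ + m
  ∤-between {m = suc _} _ m<p d = ℕ.<⇒≱ m<p (ℕ.∣⇒≤ (∣⇒∣ᵤ d))

  ∤-difference : ∀ {p x y} → x < y → y < p → ¬ + p ∣ + y - + x
  ∤-difference {x = x} {y} x<y y<p =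
    subst (λ d → ¬ _ ∣ d) (sym (trans (ℤ.m-n≡m⊖n y x) (ℤ.⊖-≥ (ℕ.<⇒≤ x<y))))
      (∤-between (ℕ.m<n⇒0<n∸m x<y) (ℕ.≤-<-trans (ℕ.m∸n≤m y x) y<p))

  residue-injective : ∀ {p x y} → x < p → y < p → + x ≡ + y [mod p ] → x ≡ y
  residue-injective {x = x} {y} x<p y<p x≡y with ℕ.<-cmp x y
  ... | tri≈ _ x≡y _ = x≡y
  ... | tri< x<y _ _ = ⊥-elim (∤-difference x<y y<p (to-∣ (≡-mod-sym x≡y)))
  ... | tri> _ _ y<x = ⊥-elim (∤-difference y<x x<p (to-∣ x≡y))

  -- Odd primes p = 2n + 1

  even-or-odd : ∀ m → (∃[ n ] m ≡ n ℕ.+ n) ⊎ (∃[ n ] m ≡ suc (n ℕ.+ n))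
  even-or-odd zero    = inj₁ (0 , refl)
  even-or-odd (suc m) with even-or-odd m
  ... | inj₁ (n , m≡n+n)   = inj₂ (n , cong suc m≡n+n)
  ... | inj₂ (n , m≡1+n+n) = inj₁ (suc n , trans (cong suc m≡1+n+n) (cong suc (sym (ℕ.+-suc n n))))

  prime≢2⇒odd : ∀ {p} → Prime p → p ≢ 2 → ∃[ n ] p ≡ suc (n ℕ.+ n)
  prime≢2⇒odd {p} p-prime p≢2 with even-or-odd p
  ... | inj₂ odd = odd
  ... | inj₁ (n , p≡n+n) with prime⇒irreducible p-prime (divides {2} n (trans p≡n+n n+n≡n*2))
    where n+n≡n*2 : n ℕ.+ n ≡ n ℕ.* 2
          n+n≡n*2 = trans (cong (n ℕ.+_) (sym (ℕ.+-identityʳ n))) (ℕ.*-comm 2 n)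
  ...   | inj₁ ()
  ...   | inj₂ 2≡p = ⊥-elim (p≢2 (sym 2≡p))

  odd-prime-∤2 : ∀ {n} → Prime (suc (n ℕ.+ n)) → ¬ + suc (n ℕ.+ n) ∣ + 2
  odd-prime-∤2 {zero}  p-prime = ⊥-elim (¬prime[1] p-prime)
  odd-prime-∤2 {suc m} _       = ∤-between (s≤s z≤n) (s≤s (s≤s (ℕ.≤-trans (s≤s z≤n) (ℕ.m≤n+m (suc m) m))))

  +[1+n+n]≡1+n+n : ∀ n → + suc (n ℕ.+ n) ≡ 1ℤ + (+ n + + n)
  +[1+n+n]≡1+n+n n = trans (ℤ.pos-+ 1 (n ℕ.+ n)) (cong (_+_ 1ℤ) (ℤ.pos-+ n n))

  inverse-of-2 : ∀ n x → x ≡ - + n * (+ 2 * x) [mod suc (n ℕ.+ n) ]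
  inverse-of-2 n x =
    from-∣ (∣-via-≡ (trans (identity (+ n) x) (cong (_* x) (sym (+[1+n+n]≡1+n+n n)))) (ℤ.∣m⇒∣m*n x ℤ.∣-refl))
    where identity : ∀ n x → x - - n * (+ 2 * x) ≡ (1ℤ + (n + n)) * x
          identity = solve-∀

  -- Finite sums and binomial sums

  ∑ : ℕ → (ℕ → ℤ) → ℤ
  ∑ zero    f = 0ℤ
  ∑ (suc m) f = f 0 + ∑ m (f ∘ suc)

  ∑-cong : ∀ m {f g} → (∀ k → f k ≡ g k) → ∑ m f ≡ ∑ m g
  ∑-cong zero    f≡g = refl
  ∑-cong (suc m) f≡g = cong₂ _+_ (f≡g 0) (∑-cong m (f≡g ∘ suc))

  ∑-distrib-+ : ∀ m f g → ∑ m (λ k → f k + g k) ≡ ∑ m f + ∑ m g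
  ∑-distrib-+ zero    f g = refl
  ∑-distrib-+ (suc m) f g =
    trans (cong (_+_ (f 0 + g 0)) (∑-distrib-+ m (f ∘ suc) (g ∘ suc))) (swap (f 0) (g 0) _ _)
    where swap : ∀ a b c d → (a + b) + (c + d) ≡ (a + c) + (b + d)
          swap = solve-∀

  ∑-*ˡ : ∀ m c f → ∑ m (λ k → c * f k) ≡ c * ∑ m f
  ∑-*ˡ zero    c f = sym (ℤ.*-zeroʳ c)
  ∑-*ˡ (suc m) c f = trans (cong (_+_ (c * f 0)) (∑-*ˡ m c (f ∘ suc))) (sym (ℤ.*-distribˡ-+ c (f 0) _))

  ∑-snoc : ∀ m f → ∑ (suc m) f ≡ ∑ m f + f m
  ∑-snoc zero    f = trans (ℤ.+-identityʳ (f 0)) (sym (ℤ.+-identityˡ (f 0)))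
  ∑-snoc (suc m) f = trans (cong (_+_ (f 0)) (∑-snoc m (f ∘ suc))) (sym (ℤ.+-assoc (f 0) _ _))

  ∑-cong-mod : ∀ {p} m {f g} → (∀ k → k < m → f k ≡ g k [mod p ]) → ∑ m f ≡ ∑ m g [mod p ]
  ∑-cong-mod zero    f≡g = ≡⇒≡-mod refl
  ∑-cong-mod (suc m) f≡g = +-cong-mod (f≡g 0 (s≤s z≤n)) (∑-cong-mod m (λ k k<m → f≡g (suc k) (s≤s k<m)))

  ∑-∣ : ∀ {p} m {f} → (∀ k → k < m → + p ∣ f k) → + p ∣ ∑ m f
  ∑-∣ zero    _  = ℤ.divides 0ℤ refl
  ∑-∣ (suc m) p∣f = ℤ.∣m∣n⇒∣m+n (p∣f 0 (s≤s z≤n)) (∑-∣ m (λ k k<m → p∣f (suc k) (s≤s k<m)))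

  binomialSum : (ℕ → ℤ) → ℕ → ℤ
  binomialSum w n = ∑ (suc n) (λ k → + (n C k) * w k)

  binomialSum-extend : ∀ w n j → ∑ (j ℕ.+ suc n) (λ k → + (n C k) * w k) ≡ binomialSum w n
  binomialSum-extend w n zero    = refl
  binomialSum-extend w n (suc j) = begin
    ∑ (suc (j ℕ.+ suc n)) term                          ≡⟨ ∑-snoc (j ℕ.+ suc n) term ⟩
    ∑ (j ℕ.+ suc n) term + + (n C (j ℕ.+ suc n)) * w _
      ≡⟨ cong (λ c → ∑ (j ℕ.+ suc n) term + + c * w (j ℕ.+ suc n)) (k>n⇒nCk≡0 (ℕ.m≤n+m (suc n) j)) ⟩
    ∑ (j ℕ.+ suc n) term + 0ℤ                           ≡⟨ ℤ.+-identityʳ _ ⟩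
    ∑ (j ℕ.+ suc n) term                                ≡⟨ binomialSum-extend w n j ⟩
    binomialSum w n                                     ∎
    where open ≡-Reasoning
          term : ℕ → ℤ
          term k = + (n C k) * w k

  binomialSum-pascal : ∀ w n → binomialSum w (suc n) ≡ binomialSum w n + binomialSum (w ∘ suc) n
  binomialSum-pascal w n = begin
    1ℤ * w 0 + ∑ (suc n) (λ k → + (suc n C suc k) * w (suc k))
      ≡⟨ cong (_+_ (1ℤ * w 0)) (∑-cong (suc n) pascal-term) ⟩
    1ℤ * w 0 + ∑ (suc n) (λ k → + (n C suc k) * w (suc k) + + (n C k) * w (suc k))
      ≡⟨ cong (_+_ (1ℤ * w 0)) (∑-distrib-+ (suc n) (λ k → + (n C suc k) * w (suc k))
                                                   (λ k → + (n C k) * w (suc k))) ⟩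
    1ℤ * w 0 + (∑ (suc n) (λ k → + (n C suc k) * w (suc k)) + binomialSum (w ∘ suc) n)
      ≡⟨ sym (ℤ.+-assoc (1ℤ * w 0) _ _) ⟩
    ∑ (2 ℕ.+ n) (λ k → + (n C k) * w k) + binomialSum (w ∘ suc) n
      ≡⟨ cong (_+ binomialSum (w ∘ suc) n) (binomialSum-extend w n 1) ⟩
    binomialSum w n + binomialSum (w ∘ suc) n ∎
    where
    open ≡-Reasoning
    pascal-term : ∀ k → + (suc n C suc k) * w (suc k) ≡ + (n C suc k) * w (suc k) + + (n C k) * w (suc k)
    pascal-term k = begin
      + (suc n C suc k) * w (suc k)               ≡⟨ cong (λ c → + c * w (suc k)) (sym (nCk+nC[k+1]≡[n+1]C[k+1] n k)) ⟩
      + (n C k ℕ.+ n C suc k) * w (suc k)          ≡⟨ cong (_* w (suc k)) (ℤ.pos-+ (n C k) (n C suc k)) ⟩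
      (+ (n C k) + + (n C suc k)) * w (suc k)      ≡⟨ ℤ.*-distribʳ-+ (w (suc k)) (+ (n C k)) (+ (n C suc k)) ⟩
      + (n C k) * w (suc k) + + (n C suc k) * w (suc k) ≡⟨ ℤ.+-comm (+ (n C k) * w (suc k)) (+ (n C suc k) * w (suc k)) ⟩
      + (n C suc k) * w (suc k) + + (n C k) * w (suc k) ∎

  binomialSum-cong : ∀ n {v w} → (∀ k → v k ≡ w k) → binomialSum v n ≡ binomialSum w n
  binomialSum-cong n v≡w = ∑-cong (suc n) (λ k → cong (+ (n C k) *_) (v≡w k))

  binomialSum-+ : ∀ v w n → binomialSum (λ k → v k + w k) n ≡ binomialSum v n + binomialSum w n
  binomialSum-+ v w n =
    trans (∑-cong (suc n) (λ k → ℤ.*-distribˡ-+ (+ (n C k)) (v k) (w k)))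
          (∑-distrib-+ (suc n) (λ k → + (n C k) * v k) (λ k → + (n C k) * w k))

  binomialSum-*ˡ : ∀ c w n → binomialSum (λ k → c * w k) n ≡ c * binomialSum w n
  binomialSum-*ˡ c w n =
    trans (∑-cong (suc n) (λ k → x∙yz≡y∙xz (+ (n C k)) c (w k))) (∑-*ˡ (suc n) c (λ k → + (n C k) * w k))
    where x∙yz≡y∙xz : ∀ x y z → x * (y * z) ≡ y * (x * z)
          x∙yz≡y∙xz = solve-∀

  binomialSum-neg : ∀ w n → binomialSum (λ k → - w k) n ≡ - binomialSum w n
  binomialSum-neg w n = trans (binomialSum-cong n (λ k → sym (ℤ.-1*i≡-i (w k))))
                              (trans (binomialSum-*ˡ -1ℤ w n) (ℤ.-1*i≡-i _))

  binomial-theorem : ∀ x n → binomialSum (x ^_) n ≡ (1ℤ + x) ^ n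
  binomial-theorem x zero    = refl
  binomial-theorem x (suc n) = begin
    binomialSum (x ^_) (suc n)                        ≡⟨ binomialSum-pascal (x ^_) n ⟩
    binomialSum (x ^_) n + binomialSum (λ k → x * x ^ k) n
      ≡⟨ cong (_+_ (binomialSum (x ^_) n)) (binomialSum-*ˡ x (x ^_) n) ⟩
    binomialSum (x ^_) n + x * binomialSum (x ^_) n   ≡⟨ cong (λ s → s + x * s) (binomial-theorem x n) ⟩
    (1ℤ + x) ^ n + x * (1ℤ + x) ^ n                   ≡⟨ factor x ((1ℤ + x) ^ n) ⟩
    (1ℤ + x) ^ suc n                                  ∎
    where
    open ≡-Reasoning
    factor : ∀ x y → y + x * y ≡ (1ℤ + x) * y
    factor = solve-∀

  [k+1]*[n+1]C[k+1]≡[n+1]*nCk : ∀ n k → suc k ℕ.* (suc n C suc k) ≡ suc n ℕ.* (n C k)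
  [k+1]*[n+1]C[k+1]≡[n+1]*nCk zero    zero    = refl
  [k+1]*[n+1]C[k+1]≡[n+1]*nCk zero    (suc k) =
    trans (cong (suc (suc k) ℕ.*_) (k>n⇒nCk≡0 {1} {suc (suc k)} (s≤s (s≤s z≤n))))
          (trans (ℕ.*-zeroʳ (suc (suc k))) (cong (1 ℕ.*_) (sym (k>n⇒nCk≡0 {0} {suc k} (s≤s z≤n)))))
  [k+1]*[n+1]C[k+1]≡[n+1]*nCk (suc n) zero    =
    trans (ℕ.*-identityˡ _) (trans (nC1≡n (suc (suc n))) (sym (ℕ.*-identityʳ (suc (suc n)))))
  [k+1]*[n+1]C[k+1]≡[n+1]*nCk (suc n) (suc k) = begin
    (2 ℕ.+ k) ℕ.* (suc (suc n) C suc (suc k))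
      ≡⟨ cong ((2 ℕ.+ k) ℕ.*_) (sym (nCk+nC[k+1]≡[n+1]C[k+1] (suc n) (suc k))) ⟩
    (2 ℕ.+ k) ℕ.* (a ℕ.+ b)                        ≡⟨ expand k a b ⟩
    suc k ℕ.* a ℕ.+ a ℕ.+ (2 ℕ.+ k) ℕ.* b
      ≡⟨ cong₂ (λ x y → x ℕ.+ a ℕ.+ y) ([k+1]*[n+1]C[k+1]≡[n+1]*nCk n k)
                                        ([k+1]*[n+1]C[k+1]≡[n+1]*nCk n (suc k)) ⟩
    suc n ℕ.* c ℕ.+ a ℕ.+ suc n ℕ.* d              ≡⟨ collect n a c d ⟩
    suc n ℕ.* (c ℕ.+ d) ℕ.+ a
      ≡⟨ cong (λ z → suc n ℕ.* z ℕ.+ a) (nCk+nC[k+1]≡[n+1]C[k+1] n k) ⟩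
    suc n ℕ.* a ℕ.+ a                              ≡⟨ ℕ.+-comm (suc n ℕ.* a) a ⟩
    (2 ℕ.+ n) ℕ.* a                                ∎
    where
    open ≡-Reasoning
    a b c d : ℕ
    a = suc n C suc k
    b = suc n C suc (suc k)
    c = n C k
    d = n C suc k
    expand : ∀ k a b → (2 ℕ.+ k) ℕ.* (a ℕ.+ b) ≡ suc k ℕ.* a ℕ.+ a ℕ.+ (2 ℕ.+ k) ℕ.* b
    expand = ℕ-Solver.solve-∀
    collect : ∀ n a c d → suc n ℕ.* c ℕ.+ a ℕ.+ suc n ℕ.* d ≡ suc n ℕ.* (c ℕ.+ d) ℕ.+ a
    collect = ℕ-Solver.solve-∀

  prime-∣-C : ∀ {p} → Prime p → ∀ {k} → 0 < k → k < p → + p ∣ + (p C k)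
  prime-∣-C {suc q} p-prime {suc j} _ k<p = prime-∣-cancelˡ p-prime (+ suc j) (∤-between (s≤s z≤n) k<p)
    (∣-via-≡ (trans (sym (ℤ.pos-* (suc j) _)) (trans (cong +_ ([k+1]*[n+1]C[k+1]≡[n+1]*nCk q j)) (ℤ.pos-* (suc q) _)))
               (ℤ.∣m⇒∣m*n (+ (q C j)) ℤ.∣-refl))

  binomialSum-frobenius : ∀ {p} → Prime p → ∀ w → binomialSum w p ≡ w 0 + w p [mod p ]
  binomialSum-frobenius {suc q} p-prime w = begin
    1ℤ * w 0 + ∑ (suc q) inner             ≡⟨ cong (_+_ (1ℤ * w 0)) (∑-snoc q inner) ⟩
    1ℤ * w 0 + (∑ q inner + inner q)
      ≈⟨ +-cong-mod (≡⇒≡-mod (ℤ.*-identityˡ (w 0)))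
                    (+-cong-mod (∣⇒≡0-mod (∑-∣ q p∣inner)) (≡⇒≡-mod last)) ⟩
    w 0 + (0ℤ + w (suc q))                 ≡⟨ cong (_+_ (w 0)) (ℤ.+-identityˡ (w (suc q))) ⟩
    w 0 + w (suc q)                        ∎
    where
    open ≡-mod-Reasoning (suc q)
    inner : ℕ → ℤ
    inner k = + (suc q C suc k) * w (suc k)
    p∣inner : ∀ k → k < q → + suc q ∣ inner k
    p∣inner k k<q = ℤ.∣m⇒∣m*n (w (suc k)) (prime-∣-C p-prime (s≤s z≤n) (s≤s k<q))
    last : inner q ≡ w (suc q)
    last = trans (cong (λ c → + c * w (suc q)) (nCn≡1 (suc q))) (ℤ.*-identityˡ (w (suc q)))

  fermat : ∀ {p} → Prime p → ∀ x → (+ x) ^ p ≡ + x [mod p ]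
  fermat {suc q} p-prime zero    = ≡⇒≡-mod (ℤ.*-zeroˡ (0ℤ ^ q))
  fermat {p}     p-prime (suc x) = begin
    (+ suc x) ^ p            ≡⟨ cong (_^ p) (ℤ.pos-+ 1 x) ⟩
    (1ℤ + + x) ^ p           ≡⟨ sym (binomial-theorem (+ x) p) ⟩
    binomialSum (_^_ (+ x)) p   ≈⟨ binomialSum-frobenius p-prime (_^_ (+ x)) ⟩
    1ℤ + (+ x) ^ p           ≈⟨ +-congˡ-mod 1ℤ (fermat p-prime x) ⟩
    1ℤ + + x                 ≡⟨ sym (ℤ.pos-+ 1 x) ⟩
    + suc x                  ∎
    where open ≡-mod-Reasoning p

  fermat-little : ∀ {p} → Prime p → ∀ {x} → ¬ + p ∣ + x → (+ x) ^ (p ℕ.∸ 1) ≡ 1ℤ [mod p ]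
  fermat-little {suc q} p-prime {x} p∤x =
    *-cancelˡ-mod p-prime (+ x) p∤x (≡-mod-trans (fermat p-prime x) (≡⇒≡-mod (sym (ℤ.*-identityʳ (+ x)))))

  -- Pairing residues off: Wilson's theorem and Euler's criterion

  module _ {A : Set} where

    ∈-─⁻ : ∀ {xs : List A} {y z} (q : y ∈ xs) → z ∈ (xs ─ q) → z ∈ xs
    ∈-─⁻ (here _)  z∈        = there z∈
    ∈-─⁻ (there q) (here eq) = here eq
    ∈-─⁻ (there q) (there z∈) = there (∈-─⁻ q z∈)

    ∈-─⁺ : ∀ {xs : List A} {y z} (q : y ∈ xs) → z ∈ xs → z ≢ y → z ∈ (xs ─ q)
    ∈-─⁺ (here refl) (here z≡y) z≢y = ⊥-elim (z≢y z≡y)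
    ∈-─⁺ (here _)    (there z∈) _   = z∈
    ∈-─⁺ (there q)   (here z≡x) _   = here z≡x
    ∈-─⁺ (there q)   (there z∈) z≢y = there (∈-─⁺ q z∈ z≢y)

    Unique-─ : ∀ {xs : List A} {y} (q : y ∈ xs) → Unique xs → Unique (xs ─ q)
    Unique-─ (here _)  (_ ∷ u)      = u
    Unique-─ (there q) (x∉ ∷ u)     = Allₚ.─⁺ q x∉ ∷ Unique-─ q u

    ∉-─ : ∀ {xs : List A} {y} (q : y ∈ xs) → Unique xs → y ∉ (xs ─ q)
    ∉-─ (here refl) (y∉ ∷ _) y∈        = All.lookup y∉ y∈ refl
    ∉-─ (there q)   (x∉ ∷ _) (here y≡x) = All.lookup x∉ q (sym y≡x)
    ∉-─ (there q)   (_ ∷ u)  (there y∈) = ∉-─ q u y∈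

  product-─ : ∀ {xs y} (q : y ∈ xs) → product xs ≡ y ℕ.* product (xs ─ q)
  product-─ (here refl)          = refl
  product-─ {x ∷ xs} {y} (there q) = begin
    x ℕ.* product xs                   ≡⟨ cong (x ℕ.*_) (product-─ q) ⟩
    x ℕ.* (y ℕ.* product (xs ─ q))     ≡⟨ x∙yz≈y∙xz x y (product (xs ─ q)) ⟩
    y ℕ.* (x ℕ.* product (xs ─ q))     ∎
    where open ≡-Reasoning

  NonzeroResidue : ℕ → ℕ → Set
  NonzeroResidue p x = 0 < x × x < p

  Paired : ℕ → ℤ → List ℕ → Set
  Paired p c xs = ∀ {x} → x ∈ xs → ∃[ y ] y ∈ xs × y ≢ x × + x * + y ≡ c [mod p ]

  module _ {p : ℕ} (p-prime : Prime p) where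

    partner-unique : ∀ {x y z c} → NonzeroResidue p z → x < p → y < p →
                     + x * + z ≡ c [mod p ] → + y * + z ≡ c [mod p ] → x ≡ y
    partner-unique {x} {y} {z} {c} (0<z , z<p) x<p y<p xz≡c yz≡c =
      residue-injective x<p y<p (*-cancelˡ-mod p-prime (+ z) (∤-between 0<z z<p) zx≡zy)
      where
      open ≡-mod-Reasoning p
      zx≡zy : + z * + x ≡ + z * + y [mod p ]
      zx≡zy = begin
        + z * + x  ≡⟨ ℤ.*-comm (+ z) (+ x) ⟩
        + x * + z  ≈⟨ xz≡c ⟩
        c          ≈⟨ ≡-mod-sym yz≡c ⟩
        + y * + z  ≡⟨ ℤ.*-comm (+ y) (+ z) ⟩
        + z * + y  ∎

    Paired-─ : ∀ {c h t y} → Unique (h ∷ t) → All (NonzeroResidue p) (h ∷ t) → Paired p c (h ∷ t) →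
               (q : y ∈ t) → + h * + y ≡ c [mod p ] → Paired p c (t ─ q)
    Paired-─ {c} {h} {t} {y} (h∉t ∷ u) res paired q hy≡c {x} x∈t─q with paired (there x∈t)
      where x∈t : x ∈ t
            x∈t = ∈-─⁻ q x∈t─q
    ... | z , here refl , _ , xh≡c = ⊥-elim (∉-─ q u (subst (_∈ (t ─ q)) x≡y x∈t─q))
      where
      x≡y : x ≡ y
      x≡y = partner-unique (All.lookup res (here refl)) (proj₂ (All.lookup res (there (∈-─⁻ q x∈t─q))))
              (proj₂ (All.lookup res (there q))) xh≡c (≡-mod-trans (≡⇒≡-mod (ℤ.*-comm (+ y) (+ h))) hy≡c)
    ... | z , there z∈t , z≢x , xz≡c with z ℕ.≟ y
    ...   | no z≢y   = z , ∈-─⁺ q z∈t z≢y , z≢x , xz≡c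
    ...   | yes refl = ⊥-elim (All.lookup h∉t (∈-─⁻ q x∈t─q) (sym x≡h))
      where
      x≡h : x ≡ h
      x≡h = partner-unique (All.lookup res (there q)) (proj₂ (All.lookup res (there (∈-─⁻ q x∈t─q))))
              (proj₂ (All.lookup res (here refl))) xz≡c hy≡c

    paired-product : ∀ c xs → Unique xs → All (NonzeroResidue p) xs → Paired p c xs →
                     ∃[ m ] (length xs ≡ m ℕ.+ m) × (+ product xs ≡ c ^ m [mod p ])
    paired-product c xs = go (length xs) xs ℕ.≤-refl
      where
      go : ∀ fuel xs → length xs ≤ fuel → Unique xs → All (NonzeroResidue p) xs → Paired p c xs →
           ∃[ m ] (length xs ≡ m ℕ.+ m) × (+ product xs ≡ c ^ m [mod p ])
      go _          []      _         _ _   _      = 0 , refl , ≡⇒≡-mod refl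
      go (suc fuel) (h ∷ t) (s≤s len) u res paired with paired (here refl)
      ... | y , here y≡h , y≢h , _ = ⊥-elim (y≢h y≡h)
      ... | y , there q , _ , hy≡c
        with go fuel (t ─ q) (ℕ.≤-trans (ℕ.n≤1+n _) (subst (_≤ fuel) (length-removeAt′ t _) len))
                (Unique-─ q (AllPairs.tail u)) (Allₚ.─⁺ q (All.tail res)) (Paired-─ u res paired q hy≡c)
      ...   | m , length≡ , product≡ = suc m , length-eq , product-eq
        where
        length-eq : suc (length t) ≡ suc m ℕ.+ suc m
        length-eq = cong suc (trans (length-removeAt′ t _) (trans (cong suc length≡) (sym (ℕ.+-suc m m))))
        open ≡-mod-Reasoning p
        product-eq : + product (h ∷ t) ≡ c ^ suc m [mod p ]
        product-eq = begin
          + (h ℕ.* product t)                         ≡⟨ cong (λ n → + (h ℕ.* n)) (product-─ q) ⟩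
          + (h ℕ.* (y ℕ.* product (t ─ q)))           ≡⟨ cong +_ (sym (ℕ.*-assoc h y _)) ⟩
          + (h ℕ.* y ℕ.* product (t ─ q))             ≡⟨ ℤ.pos-* (h ℕ.* y) _ ⟩
          + (h ℕ.* y) * + product (t ─ q)             ≡⟨ cong (_* + product (t ─ q)) (ℤ.pos-* h y) ⟩
          + h * + y * + product (t ─ q)               ≈⟨ *-cong-mod hy≡c product≡ ⟩
          c * c ^ m                                   ∎

  residue : ∀ {p} .{{_ : NonZero p}} a → ∃[ r ] r < p × + r ≡ a [mod p ]
  residue {p} a =
    a %ℕ p , n%ℕd<d a p , from-∣ (∣-via-≡ r-a≡-qp (ℤ.∣m⇒∣-m (ℤ.∣n⇒∣m*n (a /ℕ p) ℤ.∣-refl)))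
    where
    r-a≡-qp : + (a %ℕ p) - a ≡ - ((a /ℕ p) * + p)
    r-a≡-qp = trans (cong (λ b → + (a %ℕ p) - b) (a≡a%ℕn+[a/ℕn]*n a p)) (cancel (+ (a %ℕ p)) ((a /ℕ p) * + p))
      where cancel : ∀ r b → r - (r + b) ≡ - b
            cancel = solve-∀

  q≡-1[mod1+q] : ∀ q → + q ≡ -1ℤ [mod suc q ]
  q≡-1[mod1+q] q = from-∣ (∣-via-≡ (cong +_ (ℕ.+-comm q 1)) ℤ.∣-refl)

  solve-linear : ∀ {p} → Prime p → ∀ {x} → ¬ + p ∣ + x → ∀ c → ∃[ y ] y < p × + x * + y ≡ c [mod p ]
  solve-linear {p@(suc (suc q))} p-prime {x} p∤x c with residue ((+ x) ^ q * c)
  ... | y , y<p , y≡x^qc = y , y<p , (begin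
    + x * + y               ≈⟨ *-congˡ-mod (+ x) y≡x^qc ⟩
    + x * ((+ x) ^ q * c)   ≡⟨ sym (ℤ.*-assoc (+ x) ((+ x) ^ q) c) ⟩
    (+ x) ^ suc q * c       ≈⟨ *-congʳ-mod c (fermat-little p-prime p∤x) ⟩
    1ℤ * c                  ≡⟨ ℤ.*-identityˡ c ⟩
    c                       ∎)
    where open ≡-mod-Reasoning p

  square≡1 : ∀ {p} → Prime p → ∀ {a} → a * a ≡ 1ℤ [mod p ] → a ≡ 1ℤ [mod p ] ⊎ a ≡ -1ℤ [mod p ]
  square≡1 p-prime {a} (from-∣ d) with prime-∣-* p-prime (a - 1ℤ) (a + 1ℤ) (∣-via-≡ (factor a) d)
    where factor : ∀ a → (a - 1ℤ) * (a + 1ℤ) ≡ a * a - 1ℤ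
          factor = solve-∀
  ... | inj₁ d₋ = inj₁ (from-∣ d₋)
  ... | inj₂ d₊ = inj₂ (from-∣ d₊)

  residue-≢ : ∀ {p x y} → x < p → y < p → x ≢ y → ¬ + x ≡ + y [mod p ]
  residue-≢ x<p y<p x≢y = x≢y ∘ residue-injective x<p y<p

  nonzeroResidues : ℕ → List ℕ
  nonzeroResidues p = applyUpTo suc (ℕ.pred p)

  nonzeroResidues-unique : ∀ p → Unique (nonzeroResidues p)
  nonzeroResidues-unique p = applyUpTo⁺₁ suc (ℕ.pred p) (λ i<j _ → ℕ.<⇒≢ (s≤s i<j))

  nonzeroResidues-nonzero : ∀ p → All (NonzeroResidue p) (nonzeroResidues p)
  nonzeroResidues-nonzero zero    = All.[]
  nonzeroResidues-nonzero (suc q) = All.tabulate λ x∈ → case (∈-applyUpTo⁻ suc x∈)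
    where case : ∀ {x} → ∃[ i ] i < q × x ≡ suc i → NonzeroResidue (suc q) x
          case (i , i<q , refl) = s≤s z≤n , s≤s i<q

  -- The residues 2, …, p - 2 pair off with their inverses.
  module Wilson (t : ℕ) (p-prime : Prime (3 ℕ.+ t)) where

    p : ℕ
    p = 3 ℕ.+ t

    inner : List ℕ
    inner = applyUpTo (2 ℕ.+_) t

    ∈-inner : ∀ {y} → 2 ≤ y → y < 2 ℕ.+ t → y ∈ inner
    ∈-inner {y} 2≤y y<2+t = subst (_∈ inner) (ℕ.m+[n∸m]≡n 2≤y)
      (∈-applyUpTo⁺ (2 ℕ.+_)
        (ℕ.+-cancelˡ-< 2 (y ℕ.∸ 2) t (subst (_< 2 ℕ.+ t) (sym (ℕ.m+[n∸m]≡n 2≤y)) y<2+t)))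

    inner-bounds : ∀ {x} → x ∈ inner → 2 ≤ x × x < 2 ℕ.+ t
    inner-bounds x∈ with ∈-applyUpTo⁻ (2 ℕ.+_) x∈
    ... | i , i<t , refl = ℕ.m≤m+n 2 i , ℕ.+-monoʳ-< 2 i<t

    inner-nonzero : All (NonzeroResidue p) inner
    inner-nonzero = All.tabulate λ x∈ → let 2≤x , x<2+t = inner-bounds x∈ in
      ℕ.<-≤-trans (s≤s z≤n) 2≤x , ℕ.<-trans x<2+t (ℕ.n<1+n _)

    module _ {x} (x∈ : x ∈ inner) where
      private
        x<p : x < p
        x<p = proj₂ (All.lookup inner-nonzero x∈)

      x≢1 : ¬ + x ≡ 1ℤ [mod p ]
      x≢1 = residue-≢ x<p (s≤s (s≤s z≤n)) λ { refl → ℕ.<⇒≱ (proj₁ (inner-bounds x∈)) ℕ.≤-refl }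

      x≢-1 : ¬ + x ≡ -1ℤ [mod p ]
      x≢-1 x≡-1 = residue-≢ x<p (ℕ.n<1+n _) (ℕ.<⇒≢ (proj₂ (inner-bounds x∈)))
        (≡-mod-trans x≡-1 (≡-mod-sym (q≡-1[mod1+q] (2 ℕ.+ t))))

      partner : ∃[ y ] y ∈ inner × y ≢ x × + x * + y ≡ 1ℤ [mod p ]
      partner = inverse-in-inner (solve-linear p-prime (∤-between (proj₁ (All.lookup inner-nonzero x∈)) x<p) 1ℤ)
        where
        open ≡-mod-Reasoning p
        inverse-in-inner : ∃[ y ] y < p × + x * + y ≡ 1ℤ [mod p ] →
                           ∃[ y ] y ∈ inner × y ≢ x × + x * + y ≡ 1ℤ [mod p ]
        inverse-in-inner (y , y<p , xy≡1) =
          y , ∈-inner (2≤y y≢0 y≢1) (ℕ.≤∧≢⇒< (ℕ.≤-pred y<p) y≢p-1) , y≢x , xy≡1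
          where
          2≤y : ∀ {y} → y ≢ 0 → y ≢ 1 → 2 ≤ y
          2≤y {0}           y≢0 _   = ⊥-elim (y≢0 refl)
          2≤y {1}           _   y≢1 = ⊥-elim (y≢1 refl)
          2≤y {suc (suc _)} _   _   = s≤s (s≤s z≤n)
          y≢0 : y ≢ 0
          y≢0 refl = ∤-between {p} {1} (s≤s z≤n) (s≤s (s≤s z≤n))
            (≡0-mod⇒∣ (≡-mod-sym (≡-mod-trans (≡⇒≡-mod (sym (ℤ.*-zeroʳ (+ x)))) xy≡1)))
          y≢1 : y ≢ 1
          y≢1 refl = x≢1 (≡-mod-trans (≡⇒≡-mod (sym (ℤ.*-identityʳ (+ x)))) xy≡1)
          y≢p-1 : y ≢ 2 ℕ.+ t
          y≢p-1 refl = x≢-1 (≡-mod-trans (≡⇒≡-mod (sym (ℤ.neg-involutive (+ x)))) (-‿cong-mod -x≡1))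
            where
            -x≡1 : - + x ≡ 1ℤ [mod p ]
            -x≡1 = begin
              - + x       ≡⟨ trans (sym (ℤ.-1*i≡-i (+ x))) (ℤ.*-comm -1ℤ (+ x)) ⟩
              + x * -1ℤ   ≈⟨ *-congˡ-mod (+ x) (≡-mod-sym (q≡-1[mod1+q] (2 ℕ.+ t))) ⟩
              + x * + y   ≈⟨ xy≡1 ⟩
              1ℤ          ∎
          y≢x : y ≢ x
          y≢x refl = [ x≢1 , x≢-1 ]′ (square≡1 p-prime xy≡1)

    product-inner : + product inner ≡ 1ℤ [mod p ]
    product-inner = ≡-mod-trans (proj₂ (proj₂ pairing)) (≡⇒≡-mod (ℤ.^-zeroˡ (proj₁ pairing)))
      where pairing : ∃[ m ] (length inner ≡ m ℕ.+ m) × (+ product inner ≡ 1ℤ ^ m [mod p ])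
            pairing = paired-product p-prime 1ℤ inner
                        (applyUpTo⁺₁ (2 ℕ.+_) t (λ i<j _ → ℕ.<⇒≢ (ℕ.+-monoʳ-< 2 i<j))) inner-nonzero partner

    theorem : + product (nonzeroResidues p) ≡ -1ℤ [mod p ]
    theorem = begin
      + product (1 ∷ applyUpTo (2 ℕ.+_) (suc t))
        ≡⟨ cong (λ xs → + product (1 ∷ xs)) (sym (applyUpTo-∷ʳ (2 ℕ.+_) t)) ⟩
      + (1 ℕ.* product (inner ∷ʳ (2 ℕ.+ t)))
        ≡⟨ cong +_ (trans (ℕ.*-identityˡ _) (product-++ inner (2 ℕ.+ t ∷ []))) ⟩
      + (product inner ℕ.* ((2 ℕ.+ t) ℕ.* 1))
        ≡⟨ trans (ℤ.pos-* (product inner) _) (cong (λ n → + product inner * + n) (ℕ.*-identityʳ (2 ℕ.+ t))) ⟩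
      + product inner * + (2 ℕ.+ t)
        ≈⟨ *-cong-mod product-inner (q≡-1[mod1+q] (2 ℕ.+ t)) ⟩
      1ℤ * -1ℤ      ∎
      where open ≡-mod-Reasoning p

  wilson : ∀ {p} → Prime p → + product (nonzeroResidues p) ≡ -1ℤ [mod p ]
  wilson {2}                 _       = from-∣ ℤ.∣-refl
  wilson {suc (suc (suc t))} p-prime = Wilson.theorem t p-prime

  module _ {p : ℕ} {a : ℤ} where

    legendre-∣ : + p ∣ a → legendre a p ≡ 0ℤ
    legendre-∣ p∣a with (+ p) ∣? a
    ... | yes _   = refl
    ... | no  p∤a = ⊥-elim (p∤a p∣a)

    legendre-QR : ¬ + p ∣ a → QR p a → legendre a p ≡ 1ℤ
    legendre-QR p∤a qr with (+ p) ∣? a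
    ... | yes p∣a = ⊥-elim (p∤a p∣a)
    ... | no  _ with any? (λ x → (+ p) ∣? ((+ x) * (+ x) - a)) (upTo p)
    ...   | yes _   = refl
    ...   | no  ¬qr = ⊥-elim (¬qr qr)

    legendre-nonQR : ¬ + p ∣ a → ¬ QR p a → legendre a p ≡ -1ℤ
    legendre-nonQR p∤a ¬qr with (+ p) ∣? a
    ... | yes p∣a = ⊥-elim (p∤a p∣a)
    ... | no  _ with any? (λ x → (+ p) ∣? ((+ x) * (+ x) - a)) (upTo p)
    ...   | yes qr = ⊥-elim (¬qr qr)
    ...   | no  _  = refl

  QR? : ∀ p a → Dec (QR p a)
  QR? p a = any? (λ x → (+ p) ∣? ((+ x) * (+ x) - a)) (upTo p)

  ∣-resp-≡-mod : ∀ {p a b} → a ≡ b [mod p ] → + p ∣ a → + p ∣ b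
  ∣-resp-≡-mod a≡b p∣a = ≡0-mod⇒∣ (≡-mod-trans (≡-mod-sym a≡b) (∣⇒≡0-mod p∣a))

  QR-resp-≡-mod : ∀ {p a b} → a ≡ b [mod p ] → QR p a → QR p b
  QR-resp-≡-mod a≡b = Any.map λ {x} p∣x²-a → to-∣ (≡-mod-trans {a = + x * + x} (from-∣ p∣x²-a) a≡b)

  legendre-cong : ∀ {p a b} → a ≡ b [mod p ] → legendre a p ≡ legendre b p
  legendre-cong {p} {a} {b} a≡b = by-cases ((+ p) ∣? a) (QR? p a)
    where
    b≡a : b ≡ a [mod p ]
    b≡a = ≡-mod-sym a≡b
    by-cases : Dec (+ p ∣ a) → Dec (QR p a) → legendre a p ≡ legendre b p
    by-cases (yes p∣a) _        = trans (legendre-∣ p∣a) (sym (legendre-∣ (∣-resp-≡-mod a≡b p∣a)))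
    by-cases (no  p∤a) (yes qr) =
      trans (legendre-QR p∤a qr) (sym (legendre-QR (p∤a ∘ ∣-resp-≡-mod b≡a) (QR-resp-≡-mod a≡b qr)))
    by-cases (no  p∤a) (no ¬qr) =
      trans (legendre-nonQR p∤a ¬qr) (sym (legendre-nonQR (p∤a ∘ ∣-resp-≡-mod b≡a) (¬qr ∘ QR-resp-≡-mod b≡a)))

  ^-distrib-* : ∀ a b n → (a * b) ^ n ≡ a ^ n * b ^ n
  ^-distrib-* a b zero    = refl
  ^-distrib-* a b (suc n) = trans (cong (a * b *_) (^-distrib-* a b n)) (interchange a b (a ^ n) (b ^ n))
    where interchange : ∀ a b c d → a * b * (c * d) ≡ a * c * (b * d)
          interchange = solve-∀

  -- For a non-residue a, x ↦ a/x pairs off 1, …, p - 1, so aⁿ ≡ (p - 1)! ≡ -1.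
  module Euler {n : ℕ} (p-prime : Prime (suc (n ℕ.+ n))) {a : ℤ} (p∤a : ¬ + suc (n ℕ.+ n) ∣ a) where

    p : ℕ
    p = suc (n ℕ.+ n)

    QR⇒a^n≡1 : QR p a → a ^ n ≡ 1ℤ [mod p ]
    QR⇒a^n≡1 qr = root⇒a^n≡1 (Any.satisfied qr)
      where
      open ≡-mod-Reasoning p
      root⇒a^n≡1 : ∃[ x ] + p ∣ + x * + x - a → a ^ n ≡ 1ℤ [mod p ]
      root⇒a^n≡1 (x , p∣x²-a) = begin
        a ^ n                  ≈⟨ ^-cong-mod n (≡-mod-sym (from-∣ p∣x²-a)) ⟩
        (+ x * + x) ^ n        ≡⟨ ^-distrib-* (+ x) (+ x) n ⟩
        (+ x) ^ n * (+ x) ^ n  ≡⟨ sym (ℤ.^-distribˡ-+-* (+ x) n n) ⟩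
        (+ x) ^ (n ℕ.+ n)      ≈⟨ fermat-little p-prime p∤x ⟩
        1ℤ                     ∎
        where
        p∤x : ¬ + p ∣ + x
        p∤x p∣x = p∤a (∣-resp-≡-mod (from-∣ p∣x²-a) (ℤ.∣m⇒∣m*n (+ x) p∣x))

    nonQR-paired : ¬ QR p a → Paired p a (nonzeroResidues p)
    nonQR-paired ¬qr {x} x∈ = partner (solve-linear p-prime (∤-between 0<x x<p) a)
      where
      0<x : 0 < x
      0<x = proj₁ (All.lookup (nonzeroResidues-nonzero p) x∈)
      x<p : x < p
      x<p = proj₂ (All.lookup (nonzeroResidues-nonzero p) x∈)
      partner : ∃[ y ] y < p × + x * + y ≡ a [mod p ] →
                ∃[ y ] y ∈ nonzeroResidues p × y ≢ x × + x * + y ≡ a [mod p ]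
      partner (zero  , _   , x0≡a) =
        ⊥-elim (p∤a (∣-resp-≡-mod x0≡a (∣-via-≡ (ℤ.*-zeroʳ (+ x)) (ℤ.divides 0ℤ refl))))
      partner (suc j , y<p , xy≡a) = suc j , ∈-applyUpTo⁺ suc (ℕ.≤-pred y<p) , y≢x , xy≡a
        where
        y≢x : suc j ≢ x
        y≢x refl = ¬qr (Anyₚ.applyUpTo⁺ (λ i → i) (to-∣ xy≡a) x<p)

    nonQR⇒a^n≡-1 : ¬ QR p a → a ^ n ≡ -1ℤ [mod p ]
    nonQR⇒a^n≡-1 ¬qr = begin
      a ^ n                          ≡⟨ cong (a ^_) n≡m ⟩
      a ^ m                          ≈⟨ ≡-mod-sym product≡a^m ⟩
      + product (nonzeroResidues p)  ≈⟨ wilson p-prime ⟩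
      -1ℤ                            ∎
      where
      open ≡-mod-Reasoning p
      pairing : ∃[ m ] (length (nonzeroResidues p) ≡ m ℕ.+ m) × (+ product (nonzeroResidues p) ≡ a ^ m [mod p ])
      pairing = paired-product p-prime a (nonzeroResidues p)
                  (nonzeroResidues-unique p) (nonzeroResidues-nonzero p) (nonQR-paired ¬qr)
      m : ℕ
      m = proj₁ pairing
      product≡a^m : + product (nonzeroResidues p) ≡ a ^ m [mod p ]
      product≡a^m = proj₂ (proj₂ pairing)
      n≡m : n ≡ m
      n≡m = trans (ℕ.n≡⌊n+n/2⌋ n)
              (trans (cong ℕ.⌊_/2⌋ (trans (sym (length-applyUpTo suc (n ℕ.+ n))) (proj₁ (proj₂ pairing))))
                     (sym (ℕ.n≡⌊n+n/2⌋ m)))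

  euler-criterion : ∀ {n} → Prime (suc (n ℕ.+ n)) →
                    ∀ a → legendre a (suc (n ℕ.+ n)) ≡ a ^ n [mod suc (n ℕ.+ n) ]
  euler-criterion {zero}      p-prime _ = ⊥-elim (¬prime[1] p-prime)
  euler-criterion {n@(suc m)} p-prime a = by-cases ((+ p) ∣? a) (QR? p a)
    where
    p : ℕ
    p = suc (n ℕ.+ n)
    by-cases : Dec (+ p ∣ a) → Dec (QR p a) → legendre a p ≡ a ^ n [mod p ]
    by-cases (yes p∣a) _        = ≡-mod-trans (≡⇒≡-mod (legendre-∣ p∣a))
                                              (≡-mod-sym (∣⇒≡0-mod (ℤ.∣m⇒∣m*n (a ^ m) p∣a)))
    by-cases (no  p∤a) (yes qr) = ≡-mod-trans (≡⇒≡-mod (legendre-QR p∤a qr))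
                                              (≡-mod-sym (Euler.QR⇒a^n≡1 p-prime p∤a qr))
    by-cases (no  p∤a) (no ¬qr) = ≡-mod-trans (≡⇒≡-mod (legendre-nonQR p∤a ¬qr))
                                              (≡-mod-sym (Euler.nonQR⇒a^n≡-1 p-prime p∤a ¬qr))

  -- Powers of a sixth root of unity

  data Residue₆ : Set where
    r₀ r₁ r₂ r₃ r₄ r₅ : Residue₆

  next : Residue₆ → Residue₆
  next r₀ = r₁
  next r₁ = r₂
  next r₂ = r₃
  next r₃ = r₄
  next r₄ = r₅
  next r₅ = r₀

  residue₆ : ℕ → Residue₆
  residue₆ zero    = r₀
  residue₆ (suc n) = next (residue₆ n)

  double : Residue₆ → Residue₆
  double r₀ = r₀
  double r₁ = r₂
  double r₂ = r₄
  double r₃ = r₀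
  double r₄ = r₂
  double r₅ = r₄

  residue₆-double : ∀ n → residue₆ (n ℕ.+ n) ≡ double (residue₆ n)
  residue₆-double zero    = refl
  residue₆-double (suc n) = begin
    residue₆ (suc (n ℕ.+ suc n))          ≡⟨ cong (residue₆ ∘ suc) (ℕ.+-suc n n) ⟩
    next (next (residue₆ (n ℕ.+ n)))       ≡⟨ cong (next ∘ next) (residue₆-double n) ⟩
    next (next (double (residue₆ n)))      ≡⟨ double-next (residue₆ n) ⟩
    double (next (residue₆ n))             ∎
    where
    open ≡-Reasoning
    double-next : ∀ r → next (next (double r)) ≡ double (next r)
    double-next r₀ = refl
    double-next r₁ = refl
    double-next r₂ = refl
    double-next r₃ = refl
    double-next r₄ = refl
    double-next r₅ = refl

  -- θᵏ = θ₀ k + θ₁ k · θ in ℤ[θ], θ² = θ - 1; the coefficients depend only on k mod 6.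
  coeff₀ coeff₁ : Residue₆ → ℤ
  coeff₀ r₀ = 1ℤ
  coeff₀ r₁ = 0ℤ
  coeff₀ r₂ = -1ℤ
  coeff₀ r₃ = -1ℤ
  coeff₀ r₄ = 0ℤ
  coeff₀ r₅ = 1ℤ
  coeff₁ r₀ = 0ℤ
  coeff₁ r₁ = 1ℤ
  coeff₁ r₂ = 1ℤ
  coeff₁ r₃ = 0ℤ
  coeff₁ r₄ = -1ℤ
  coeff₁ r₅ = -1ℤ

  θ₀ θ₁ : ℕ → ℤ
  θ₀ = coeff₀ ∘ residue₆
  θ₁ = coeff₁ ∘ residue₆

  θ₀-suc : ∀ k → θ₀ (suc k) ≡ - θ₁ k
  θ₀-suc k = table (residue₆ k)
    where table : ∀ r → coeff₀ (next r) ≡ - coeff₁ r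
          table r₀ = refl
          table r₁ = refl
          table r₂ = refl
          table r₃ = refl
          table r₄ = refl
          table r₅ = refl

  θ₁-suc : ∀ k → θ₁ (suc k) ≡ θ₀ k + θ₁ k
  θ₁-suc k = table (residue₆ k)
    where table : ∀ r → coeff₁ (next r) ≡ coeff₀ r + coeff₁ r
          table r₀ = refl
          table r₁ = refl
          table r₂ = refl
          table r₃ = refl
          table r₄ = refl
          table r₅ = refl

  θ₀-suc-suc : ∀ k → θ₀ (suc (suc k)) ≡ - (θ₀ k + θ₁ k)
  θ₀-suc-suc k = trans (θ₀-suc (suc k)) (cong -_ (θ₁-suc k))

  θ₁-suc-suc : ∀ k → θ₁ (suc (suc k)) ≡ θ₀ k
  θ₁-suc-suc k = begin
    θ₁ (suc (suc k))                   ≡⟨ θ₁-suc (suc k) ⟩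
    θ₀ (suc k) + θ₁ (suc k)            ≡⟨ cong₂ _+_ (θ₀-suc k) (θ₁-suc k) ⟩
    - θ₁ k + (θ₀ k + θ₁ k)             ≡⟨ cancel (θ₀ k) (θ₁ k) ⟩
    θ₀ k                               ∎
    where
    open ≡-Reasoning
    cancel : ∀ a b → - b + (a + b) ≡ a
    cancel = solve-∀

  -- ω = θ² is a primitive cube root of unity, and ωᵏ = ω₀ k + ω₁ k · θ.
  ω₀ ω₁ : ℕ → ℤ
  ω₀ k = θ₀ (k ℕ.+ k)
  ω₁ k = θ₁ (k ℕ.+ k)

  ω₀-suc : ∀ k → ω₀ (suc k) ≡ - (ω₀ k + ω₁ k)
  ω₀-suc k = trans (cong (θ₀ ∘ suc) (ℕ.+-suc k k)) (θ₀-suc-suc (k ℕ.+ k))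

  ω₁-suc : ∀ k → ω₁ (suc k) ≡ ω₀ k
  ω₁-suc k = trans (cong (θ₁ ∘ suc) (ℕ.+-suc k k)) (θ₁-suc-suc (k ℕ.+ k))

  -- (1 + ω)ⁿ = θⁿ, since 1 + ω = θ.
  binomialSum-ω : ∀ n → binomialSum ω₀ n ≡ θ₀ n × binomialSum ω₁ n ≡ θ₁ n
  binomialSum-ω zero    = refl , refl
  binomialSum-ω (suc n) with binomialSum-ω n
  ... | S₀ , S₁ = (begin
    binomialSum ω₀ (suc n)                              ≡⟨ binomialSum-pascal ω₀ n ⟩
    binomialSum ω₀ n + binomialSum (ω₀ ∘ suc) n
      ≡⟨ cong (_+_ (binomialSum ω₀ n)) (binomialSum-cong n ω₀-suc) ⟩
    binomialSum ω₀ n + binomialSum (λ k → - (ω₀ k + ω₁ k)) n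
      ≡⟨ cong (_+_ (binomialSum ω₀ n))
              (trans (binomialSum-neg (λ k → ω₀ k + ω₁ k) n) (cong -_ (binomialSum-+ ω₀ ω₁ n))) ⟩
    binomialSum ω₀ n - (binomialSum ω₀ n + binomialSum ω₁ n) ≡⟨ cong₂ (λ a b → a - (a + b)) S₀ S₁ ⟩
    θ₀ n - (θ₀ n + θ₁ n)                                 ≡⟨ cancel (θ₀ n) (θ₁ n) ⟩
    - θ₁ n                                              ≡⟨ sym (θ₀-suc n) ⟩
    θ₀ (suc n)                                          ∎) , (begin
    binomialSum ω₁ (suc n)                              ≡⟨ binomialSum-pascal ω₁ n ⟩
    binomialSum ω₁ n + binomialSum (ω₁ ∘ suc) n
      ≡⟨ cong (_+_ (binomialSum ω₁ n)) (binomialSum-cong n ω₁-suc) ⟩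
    binomialSum ω₁ n + binomialSum ω₀ n                 ≡⟨ cong₂ _+_ S₁ S₀ ⟩
    θ₁ n + θ₀ n                                         ≡⟨ trans (ℤ.+-comm (θ₁ n) (θ₀ n)) (sym (θ₁-suc n)) ⟩
    θ₁ (suc n)                                          ∎)
    where
    open ≡-Reasoning
    cancel : ∀ a b → a - (a + b) ≡ - b
    cancel = solve-∀

  -- Multiplication by 1 + θ, read off in coordinates.
  binomialSum-θ₀-suc : ∀ m → binomialSum θ₀ (suc m) ≡ binomialSum θ₀ m - binomialSum θ₁ m
  binomialSum-θ₀-suc m = trans (binomialSum-pascal θ₀ m)
    (cong (_+_ (binomialSum θ₀ m)) (trans (binomialSum-cong m θ₀-suc) (binomialSum-neg θ₁ m)))

  binomialSum-θ₁-suc : ∀ m →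
    binomialSum θ₁ (suc m) ≡ binomialSum θ₁ m + (binomialSum θ₀ m + binomialSum θ₁ m)
  binomialSum-θ₁-suc m = trans (binomialSum-pascal θ₁ m)
    (cong (_+_ (binomialSum θ₁ m)) (trans (binomialSum-cong m θ₁-suc) (binomialSum-+ θ₀ θ₁ m)))

  -- (1 + θ)² = 3θ, so (1 + θ)²ⁿ = 3ⁿθⁿ.
  binomialSum-θ-even : ∀ n →
    binomialSum θ₀ (n ℕ.+ n) ≡ (+ 3) ^ n * θ₀ n × binomialSum θ₁ (n ℕ.+ n) ≡ (+ 3) ^ n * θ₁ n
  binomialSum-θ-even zero    = refl , refl
  binomialSum-θ-even (suc n) with binomialSum-θ-even n
  ... | E≡ , F≡ = (begin
    binomialSum θ₀ (suc n ℕ.+ suc n)       ≡⟨ cong (binomialSum θ₀) 2+2n ⟩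
    binomialSum θ₀ (suc (suc (n ℕ.+ n)))   ≡⟨ trans (binomialSum-θ₀-suc (suc (n ℕ.+ n)))
                                                    (cong₂ _-_ (binomialSum-θ₀-suc (n ℕ.+ n)) (binomialSum-θ₁-suc (n ℕ.+ n))) ⟩
    (E - F) - (F + (E + F))                ≡⟨ collect₀ E F ⟩
    + 3 * (- F)                            ≡⟨ cong (λ f → + 3 * - f) F≡ ⟩
    + 3 * - ((+ 3) ^ n * θ₁ n)               ≡⟨ regroup₀ ((+ 3) ^ n) (θ₁ n) ⟩
    (+ 3) ^ suc n * - θ₁ n                   ≡⟨ cong ((+ 3) ^ suc n *_) (sym (θ₀-suc n)) ⟩
    (+ 3) ^ suc n * θ₀ (suc n)               ∎) , (begin
    binomialSum θ₁ (suc n ℕ.+ suc n)       ≡⟨ cong (binomialSum θ₁) 2+2n ⟩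
    binomialSum θ₁ (suc (suc (n ℕ.+ n)))   ≡⟨ trans (binomialSum-θ₁-suc (suc (n ℕ.+ n)))
                                                    (cong₂ (λ a b → a + (b + a)) (binomialSum-θ₁-suc (n ℕ.+ n)) (binomialSum-θ₀-suc (n ℕ.+ n))) ⟩
    (F + (E + F)) + ((E - F) + (F + (E + F))) ≡⟨ collect₁ E F ⟩
    + 3 * (E + F)                          ≡⟨ cong₂ (λ e f → + 3 * (e + f)) E≡ F≡ ⟩
    + 3 * ((+ 3) ^ n * θ₀ n + (+ 3) ^ n * θ₁ n) ≡⟨ regroup₁ ((+ 3) ^ n) (θ₀ n) (θ₁ n) ⟩
    (+ 3) ^ suc n * (θ₀ n + θ₁ n)            ≡⟨ cong ((+ 3) ^ suc n *_) (sym (θ₁-suc n)) ⟩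
    (+ 3) ^ suc n * θ₁ (suc n)               ∎)
    where
    open ≡-Reasoning
    E F : ℤ
    E = binomialSum θ₀ (n ℕ.+ n)
    F = binomialSum θ₁ (n ℕ.+ n)
    2+2n : suc n ℕ.+ suc n ≡ suc (suc (n ℕ.+ n))
    2+2n = cong suc (ℕ.+-suc n n)
    collect₀ : ∀ e f → (e - f) - (f + (e + f)) ≡ + 3 * (- f)
    collect₀ = solve-∀
    regroup₀ : ∀ c t → + 3 * - (c * t) ≡ (+ 3 * c) * - t
    regroup₀ = solve-∀
    collect₁ : ∀ e f → (f + (e + f)) + ((e - f) + (f + (e + f))) ≡ + 3 * (e + f)
    collect₁ = solve-∀
    regroup₁ : ∀ c a b → + 3 * (c * a + c * b) ≡ (+ 3 * c) * (a + b)
    regroup₁ = solve-∀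

  3^n-congruence : ∀ {n} → Prime (suc (n ℕ.+ n)) →
                   (+ 3) ^ n * (θ₀ n - θ₁ n) ≡ 1ℤ + θ₀ (suc (n ℕ.+ n)) [mod suc (n ℕ.+ n) ]
  3^n-congruence {n} p-prime = begin
    (+ 3) ^ n * (θ₀ n - θ₁ n)                   ≡⟨ distrib ((+ 3) ^ n) (θ₀ n) (θ₁ n) ⟩
    (+ 3) ^ n * θ₀ n - (+ 3) ^ n * θ₁ n
      ≡⟨ sym (cong₂ _-_ (proj₁ (binomialSum-θ-even n)) (proj₂ (binomialSum-θ-even n))) ⟩
    binomialSum θ₀ (n ℕ.+ n) - binomialSum θ₁ (n ℕ.+ n) ≡⟨ sym (binomialSum-θ₀-suc (n ℕ.+ n)) ⟩
    binomialSum θ₀ (suc (n ℕ.+ n))            ≈⟨ binomialSum-frobenius p-prime θ₀ ⟩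
    1ℤ + θ₀ (suc (n ℕ.+ n))                   ∎
    where
    open ≡-mod-Reasoning (suc (n ℕ.+ n))
    distrib : ∀ c a b → c * (a - b) ≡ c * a - c * b
    distrib = solve-∀

  legendre-mod-3 : ∀ k → legendre (+ k) 3 ≡ ω₁ k
  legendre-mod-3 0 = refl
  legendre-mod-3 1 = refl
  legendre-mod-3 2 = refl
  legendre-mod-3 (suc (suc (suc k))) = begin
    legendre (+ (3 ℕ.+ k)) 3
      ≡⟨ legendre-cong {3} {+ (3 ℕ.+ k)} {+ k} (from-∣ (ℤ.∣-reflexive 3+k-k≡3)) ⟩
    legendre (+ k) 3                  ≡⟨ legendre-mod-3 k ⟩
    ω₁ k                              ≡⟨ cancel (ω₀ k) (ω₁ k) ⟩
    - (- (ω₀ k + ω₁ k) + ω₀ k)        ≡⟨ cong (λ a → - (a + ω₀ k)) (sym (ω₀-suc k)) ⟩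
    - (ω₀ (suc k) + ω₀ k)             ≡⟨ cong (λ b → - (ω₀ (suc k) + b)) (sym (ω₁-suc k)) ⟩
    - (ω₀ (suc k) + ω₁ (suc k))       ≡⟨ sym (ω₀-suc (suc k)) ⟩
    ω₀ (suc (suc k))                  ≡⟨ sym (ω₁-suc (suc (suc k))) ⟩
    ω₁ (suc (suc (suc k)))            ∎
    where
    open ≡-Reasoning
    cancel : ∀ a b → b ≡ - (- (a + b) + a)
    cancel = solve-∀
    3+k-k≡3 : + 3 ≡ + (3 ℕ.+ k) - + k
    3+k-k≡3 = trans (add-sub (+ k)) (cong (_- + k) (sym (ℤ.pos-+ 3 k)))
      where add-sub : ∀ x → + 3 ≡ + 3 + x - x
            add-sub = solve-∀

  binomialSum-legendre-3 : ∀ n → binomialSum (λ k → legendre (+ k) 3) n ≡ θ₁ n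
  binomialSum-legendre-3 n = trans (binomialSum-cong n legendre-mod-3) (proj₂ (binomialSum-ω n))

  sign : Residue₆ → ℤ
  sign r₀ = 1ℤ
  sign r₁ = -1ℤ
  sign r₂ = 1ℤ
  sign r₃ = -1ℤ
  sign r₄ = 1ℤ
  sign r₅ = -1ℤ

  -1^n≡sign : ∀ n → -1ℤ ^ n ≡ sign (residue₆ n)
  -1^n≡sign zero    = refl
  -1^n≡sign (suc n) = trans (cong (-1ℤ *_) (-1^n≡sign n)) (table (residue₆ n))
    where table : ∀ r → -1ℤ * sign r ≡ sign (next r)
          table r₀ = refl
          table r₁ = refl
          table r₂ = refl
          table r₃ = refl
          table r₄ = refl
          table r₅ = refl

  -- M stands for 3ⁿ, with r = n mod 6: the hypotheses are the Frobenius congruence for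
  -- (1 + θ)ᵖ and the fact that 3ⁿ ≡ 0 only when p = 3.
  twice-coeff₁≡sign-M : ∀ {p} → Prime p → ¬ + p ∣ + 2 → ∀ r M → (+ p ∣ M → + p ∣ + 3) →
                  M * (coeff₀ r - coeff₁ r) ≡ 1ℤ + coeff₀ (next (double r)) [mod p ] →
                  + 2 * coeff₁ r ≡ sign r - M [mod p ]
  twice-coeff₁≡sign-M _ _ r₀ M _ (from-∣ h) = from-∣ (∣-via-≡ (identity M) h)
    where identity : ∀ M → + 2 * 0ℤ - (1ℤ - M) ≡ M * (1ℤ - 0ℤ) - (1ℤ + 0ℤ)
          identity = solve-∀
  twice-coeff₁≡sign-M {p} _ _ r₁ M p∣M⇒p∣3 (from-∣ h) =
    from-∣ (∣-via-≡ (identity M) (ℤ.∣m∣n⇒∣m+n (p∣M⇒p∣3 p∣M) p∣M))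
    where identity : ∀ M → + 2 * 1ℤ - (-1ℤ - M) ≡ + 3 + M
          identity = solve-∀
          p∣M : + p ∣ M
          p∣M = ∣-via-≡ (M≡ M) (ℤ.∣m⇒∣-m h)
            where M≡ : ∀ M → M ≡ - (M * (0ℤ - 1ℤ) - (1ℤ + -1ℤ))
                  M≡ = solve-∀
  twice-coeff₁≡sign-M p-prime p∤2 r₂ M _ (from-∣ h) =
    from-∣ (∣-via-≡ (identity M) (prime-∣-cancelˡ p-prime (+ 2) p∤2 (∣-via-≡ (2[M+1]≡ M) (ℤ.∣m⇒∣-m h))))
    where identity : ∀ M → + 2 * 1ℤ - (1ℤ - M) ≡ M + 1ℤ
          identity = solve-∀
          2[M+1]≡ : ∀ M → + 2 * (M + 1ℤ) ≡ - (M * (-1ℤ - 1ℤ) - (1ℤ + 1ℤ))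
          2[M+1]≡ = solve-∀
  twice-coeff₁≡sign-M _ _ r₃ M _ (from-∣ h) = from-∣ (∣-via-≡ (identity M) (ℤ.∣m⇒∣-m h))
    where identity : ∀ M → + 2 * 0ℤ - (-1ℤ - M) ≡ - (M * (-1ℤ - 0ℤ) - (1ℤ + 0ℤ))
          identity = solve-∀
  twice-coeff₁≡sign-M {p} _ _ r₄ M p∣M⇒p∣3 (from-∣ h) =
    from-∣ (∣-via-≡ (identity M) (ℤ.∣m∣n⇒∣m-n p∣M (p∣M⇒p∣3 p∣M)))
    where identity : ∀ M → + 2 * -1ℤ - (1ℤ - M) ≡ M - + 3
          identity = solve-∀
          p∣M : + p ∣ M
          p∣M = ∣-via-≡ (M≡ M) h
            where M≡ : ∀ M → M ≡ M * (0ℤ - -1ℤ) - (1ℤ + -1ℤ)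
                  M≡ = solve-∀
  twice-coeff₁≡sign-M p-prime p∤2 r₅ M _ (from-∣ h) =
    from-∣ (∣-via-≡ (identity M) (prime-∣-cancelˡ p-prime (+ 2) p∤2 (∣-via-≡ (2[M-1]≡ M) h)))
    where identity : ∀ M → + 2 * -1ℤ - (-1ℤ - M) ≡ M - 1ℤ
          identity = solve-∀
          2[M-1]≡ : ∀ M → + 2 * (M - 1ℤ) ≡ M * (1ℤ - -1ℤ) - (1ℤ + 1ℤ)
          2[M-1]≡ = solve-∀

  twice-binomialSum-legendre-3 : ∀ {n} → Prime (suc (n ℕ.+ n)) →
    + 2 * binomialSum (λ k → legendre (+ k) 3) n
      ≡ legendre -1ℤ (suc (n ℕ.+ n)) - legendre (+ 3) (suc (n ℕ.+ n)) [mod suc (n ℕ.+ n) ]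
  twice-binomialSum-legendre-3 {zero}      p-prime = ⊥-elim (¬prime[1] p-prime)
  twice-binomialSum-legendre-3 {n@(suc m)} p-prime = begin
    + 2 * binomialSum (λ k → legendre (+ k) 3) n  ≡⟨ cong (+ 2 *_) (binomialSum-legendre-3 n) ⟩
    + 2 * coeff₁ (residue₆ n)
      ≈⟨ twice-coeff₁≡sign-M p-prime (odd-prime-∤2 {n} p-prime) (residue₆ n) ((+ 3) ^ n)
                             (prime-∣-^ p-prime (+ 3) m) 3^n-action ⟩
    sign (residue₆ n) - (+ 3) ^ n                 ≡⟨ cong (_- (+ 3) ^ n) (sym (-1^n≡sign n)) ⟩
    -1ℤ ^ n - (+ 3) ^ n
      ≈⟨ ≡-mod-sym (-cong-mod (euler-criterion {n} p-prime -1ℤ) (euler-criterion {n} p-prime (+ 3))) ⟩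
    legendre -1ℤ p - legendre (+ 3) p             ∎
    where
    open ≡-mod-Reasoning (suc (n ℕ.+ n))
    p : ℕ
    p = suc (n ℕ.+ n)
    3^n-action : (+ 3) ^ n * (coeff₀ (residue₆ n) - coeff₁ (residue₆ n))
                   ≡ 1ℤ + coeff₀ (next (double (residue₆ n))) [mod p ]
    3^n-action = ≡-mod-trans (3^n-congruence {n} p-prime)
                             (≡⇒≡-mod (cong (λ r → 1ℤ + coeff₀ (next r)) (residue₆-double n)))

  -- Central binomial coefficients modulo 2n + 1

  [k+1]*mC[k+1]≡[m-k]*mCk : ∀ m k → + suc k * + (m C suc k) ≡ (+ m - + k) * + (m C k)
  [k+1]*mC[k+1]≡[m-k]*mCk m k = begin
    + suc k * b                               ≡⟨ expand (+ k) a b ⟩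
    + suc k * (a + b) - + suc k * a           ≡⟨ cong (λ c → + suc k * c - + suc k * a) (sym pascal) ⟩
    + suc k * + (suc m C suc k) - + suc k * a ≡⟨ cong (_- + suc k * a) absorption ⟩
    + suc m * a - + suc k * a                 ≡⟨ collect (+ m) (+ k) a ⟩
    (+ m - + k) * a                           ∎
    where
    open ≡-Reasoning
    a b : ℤ
    a = + (m C k)
    b = + (m C suc k)
    pascal : + (suc m C suc k) ≡ a + b
    pascal = trans (cong +_ (sym (nCk+nC[k+1]≡[n+1]C[k+1] m k))) (ℤ.pos-+ (m C k) _)
    absorption : + suc k * + (suc m C suc k) ≡ + suc m * a
    absorption = trans (sym (ℤ.pos-* (suc k) _)) (trans (cong +_ ([k+1]*[n+1]C[k+1]≡[n+1]*nCk m k)) (ℤ.pos-* (suc m) _))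
    expand : ∀ k a b → (1ℤ + k) * b ≡ (1ℤ + k) * (a + b) - (1ℤ + k) * a
    expand = solve-∀
    collect : ∀ m k a → (1ℤ + m) * a - (1ℤ + k) * a ≡ (m - k) * a
    collect = solve-∀

  [k+1]*[2k+2]C[k+1]≡2[2k+1]*[2k]Ck : ∀ k →
    suc k ℕ.* ((2 ℕ.* suc k) C suc k) ≡ 2 ℕ.* suc (2 ℕ.* k) ℕ.* ((2 ℕ.* k) C k)
  [k+1]*[2k+2]C[k+1]≡2[2k+1]*[2k]Ck k = begin
    suc k ℕ.* ((2 ℕ.* suc k) C suc k)      ≡⟨ cong (λ m → suc k ℕ.* (m C suc k)) (ℕ.*-suc 2 k) ⟩
    suc k ℕ.* (suc (suc 2k) C suc k)       ≡⟨ [k+1]*[n+1]C[k+1]≡[n+1]*nCk (suc 2k) k ⟩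
    suc (suc 2k) ℕ.* (suc 2k C k)          ≡⟨ cong (suc (suc 2k) ℕ.*_) symmetry ⟩
    suc (suc 2k) ℕ.* (suc 2k C suc k)      ≡⟨ regroup k (suc 2k C suc k) ⟩
    2 ℕ.* (suc k ℕ.* (suc 2k C suc k))     ≡⟨ cong (2 ℕ.*_) ([k+1]*[n+1]C[k+1]≡[n+1]*nCk 2k k) ⟩
    2 ℕ.* (suc 2k ℕ.* (2k C k))            ≡⟨ sym (ℕ.*-assoc 2 (suc 2k) (2k C k)) ⟩
    2 ℕ.* suc 2k ℕ.* (2k C k)              ∎
    where
    open ≡-Reasoning
    2k : ℕ
    2k = 2 ℕ.* k
    symmetry : suc 2k C k ≡ suc 2k C suc k
    symmetry = trans (nCk≡nC[n∸k] (ℕ.≤-trans k≤2k (ℕ.n≤1+n 2k)))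
                     (cong (suc 2k C_) (trans (ℕ.+-∸-assoc 1 k≤2k)
                                              (cong suc (trans (ℕ.m+n∸m≡n k (k ℕ.+ 0)) (ℕ.+-identityʳ k)))))
      where k≤2k : k ℕ.≤ 2k
            k≤2k = ℕ.m≤m+n k (k ℕ.+ 0)
    regroup : ∀ k c → suc (suc (2 ℕ.* k)) ℕ.* c ≡ 2 ℕ.* (suc k ℕ.* c)
    regroup = ℕ-Solver.solve-∀

  module _ {n : ℕ} (p-prime : Prime (suc (n ℕ.+ n))) where

    private
      p : ℕ
      p = suc (n ℕ.+ n)
      Q : ℤ
      Q = - (+ n * + n)

    -- -n² is the inverse of -4 and -1/2 ≡ n, so this is C(2k,k)/(-4)ᵏ = C(-1/2,k) ≡ C(n,k).
    central-binomial-congruence : ∀ k → k < p → + ((2 ℕ.* k) C k) * Q ^ k ≡ + (n C k) [mod p ]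
    central-binomial-congruence zero    _   = ≡⇒≡-mod refl
    central-binomial-congruence (suc k) k<p =
      *-cancelˡ-mod p-prime (+ suc k) (∤-between (s≤s z≤n) k<p) (begin
        + suc k * (D (suc k) * Q ^ suc k)                  ≡⟨ regroup (+ suc k) (D (suc k)) Q (Q ^ k) ⟩
        (+ suc k * D (suc k)) * Q * Q ^ k                   ≡⟨ cong (λ c → c * Q * Q ^ k) central-step ⟩
        + 2 * (1ℤ + + 2 * + k) * D k * Q * Q ^ k            ≡⟨ regroup′ (+ 2 * (1ℤ + + 2 * + k)) (D k) Q (Q ^ k) ⟩
        (+ 2 * (1ℤ + + 2 * + k) * Q) * (D k * Q ^ k)
          ≈⟨ *-cong-mod coefficient (central-binomial-congruence k (ℕ.<-trans (ℕ.n<1+n k) k<p)) ⟩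
        (+ n - + k) * + (n C k)                             ≡⟨ sym ([k+1]*mC[k+1]≡[m-k]*mCk n k) ⟩
        + suc k * + (n C suc k)                             ∎)
      where
      open ≡-mod-Reasoning p
      D : ℕ → ℤ
      D k = + ((2 ℕ.* k) C k)
      regroup : ∀ a d q r → a * (d * (q * r)) ≡ a * d * q * r
      regroup = solve-∀
      regroup′ : ∀ c d q r → c * d * q * r ≡ (c * q) * (d * r)
      regroup′ = solve-∀
      central-step : + suc k * D (suc k) ≡ + 2 * (1ℤ + + 2 * + k) * D k
      central-step =
        trans (sym (ℤ.pos-* (suc k) _))
       (trans (cong +_ ([k+1]*[2k+2]C[k+1]≡2[2k+1]*[2k]Ck k))
       (trans (ℤ.pos-* (2 ℕ.* suc (2 ℕ.* k)) _)
              (cong (_* D k) (trans (ℤ.pos-* 2 (suc (2 ℕ.* k)))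
                                    (cong (+ 2 *_) (trans (ℤ.pos-+ 1 (2 ℕ.* k)) (cong (_+_ 1ℤ) (ℤ.pos-* 2 k))))))))
      coefficient : + 2 * (1ℤ + + 2 * + k) * Q ≡ + n - + k [mod p ]
      coefficient = from-∣ (∣-via-≡ (trans (identity (+ n) (+ k))
                                            (cong (_* (+ k - + n * (1ℤ + + 2 * + k))) (sym (+[1+n+n]≡1+n+n n))))
                                       (ℤ.∣m⇒∣m*n _ ℤ.∣-refl))
        where
        identity : ∀ n k → + 2 * (1ℤ + + 2 * k) * - (n * n) - (n - k) ≡ (1ℤ + (n + n)) * (k - n * (1ℤ + + 2 * k))
        identity = solve-∀

    central-binomial-sum : ∀ w → ∑ p (λ k → w k * + ((2 ℕ.* k) C k) * Q ^ k) ≡ binomialSum w n [mod p ]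
    central-binomial-sum w = begin
      ∑ p (λ k → w k * + ((2 ℕ.* k) C k) * Q ^ k)
        ≈⟨ ∑-cong-mod p termwise ⟩
      ∑ p (λ k → + (n C k) * w k)           ≡⟨ cong (λ m → ∑ m (λ k → + (n C k) * w k)) (sym (ℕ.+-suc n n)) ⟩
      ∑ (n ℕ.+ suc n) (λ k → + (n C k) * w k) ≡⟨ binomialSum-extend w n n ⟩
      binomialSum w n                       ∎
      where
      open ≡-mod-Reasoning p
      termwise : ∀ k → k < p → w k * + ((2 ℕ.* k) C k) * Q ^ k ≡ + (n C k) * w k [mod p ]
      termwise k k<p = begin
        w k * + ((2 ℕ.* k) C k) * Q ^ k     ≡⟨ ℤ.*-assoc (w k) _ _ ⟩
        w k * (+ ((2 ℕ.* k) C k) * Q ^ k)   ≈⟨ *-congˡ-mod (w k) (central-binomial-congruence k k<p) ⟩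
        w k * + (n C k)                     ≡⟨ ℤ.*-comm (w k) _ ⟩
        + (n C k) * w k                     ∎

  -- Rationals with denominator prime to p

  infix 4 _≡ᵘ_[mod_] _≡ʳ_[mod_]
  record _≡ᵘ_[mod_] (u : ℚᵘ) (z : ℤ) (p : ℕ) : Set where
    constructor p-integral
    field
      p∤↧ : ¬ + p ∣ ↧ᵘ u
      ↥≡z↧ : ↥ᵘ u ≡ z * ↧ᵘ u [mod p ]
  open _≡ᵘ_[mod_] public

  _≡ʳ_[mod_] : ℚ → ℤ → ℕ → Set
  q ≡ʳ z [mod p ] = toℚᵘ q ≡ᵘ z [mod p ]

  ≡ᵘ-neg : ∀ {p u a} → u ≡ᵘ a [mod p ] → ℚᵘ.- u ≡ᵘ - a [mod p ]
  ≡ᵘ-neg {u = mkℚᵘ _ _} {a} (p-integral p∤↧ ↥≡) =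
    p-integral p∤↧ (≡-mod-trans (-‿cong-mod ↥≡) (≡⇒≡-mod (ℤ.neg-distribˡ-* a _)))

  ≡ᵘ-resp-≡-mod : ∀ {p u a b} → u ≡ᵘ a [mod p ] → a ≡ b [mod p ] → u ≡ᵘ b [mod p ]
  ≡ᵘ-resp-≡-mod (p-integral p∤↧ ↥≡) a≡b = p-integral p∤↧ (≡-mod-trans ↥≡ (*-congʳ-mod _ a≡b))

  module _ {p : ℕ} (p-prime : Prime p) where

    private
      p∤1 : ¬ + p ∣ 1ℤ
      p∤1 p∣1 = ¬prime[1] (subst Prime (ℕ.∣1⇒≡1 (∣⇒∣ᵤ p∣1)) p-prime)

      p∤↧-* : ∀ d₁ d₂ → ¬ + p ∣ + suc d₁ → ¬ + p ∣ + suc d₂ → ¬ + p ∣ + (suc d₁ ℕ.* suc d₂)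
      p∤↧-* d₁ d₂ p∤d₁ p∤d₂ = prime-∤-* p-prime p∤d₁ p∤d₂ ∘ ∣-via-≡ (sym (ℤ.pos-* (suc d₁) (suc d₂)))

    ≡ᵘ-integer : ∀ z → mkℚᵘ z 0 ≡ᵘ z [mod p ]
    ≡ᵘ-integer z = p-integral p∤1 (≡⇒≡-mod (sym (ℤ.*-identityʳ z)))

    ≡ᵘ-+ : ∀ {u v a b} → u ≡ᵘ a [mod p ] → v ≡ᵘ b [mod p ] → u ℚᵘ.+ v ≡ᵘ a + b [mod p ]
    ≡ᵘ-+ {mkℚᵘ _ d₁} {mkℚᵘ _ d₂} {a} {b} (p-integral p∤d₁ ↥u≡) (p-integral p∤d₂ ↥v≡) =
      p-integral (p∤↧-* d₁ d₂ p∤d₁ p∤d₂)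
        (≡-mod-trans (+-cong-mod (*-congʳ-mod (+ suc d₂) ↥u≡) (*-congʳ-mod (+ suc d₁) ↥v≡))
          (≡⇒≡-mod (trans (collect a b (+ suc d₁) (+ suc d₂))
                          (cong ((a + b) *_) (sym (ℤ.pos-* (suc d₁) (suc d₂)))))))
      where collect : ∀ a b e f → a * e * f + b * f * e ≡ (a + b) * (e * f)
            collect = solve-∀

    ≡ᵘ-* : ∀ {u v a b} → u ≡ᵘ a [mod p ] → v ≡ᵘ b [mod p ] → u ℚᵘ.* v ≡ᵘ a * b [mod p ]
    ≡ᵘ-* {mkℚᵘ _ d₁} {mkℚᵘ _ d₂} {a} {b} (p-integral p∤d₁ ↥u≡) (p-integral p∤d₂ ↥v≡) =
      p-integral (p∤↧-* d₁ d₂ p∤d₁ p∤d₂)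
        (≡-mod-trans (*-cong-mod ↥u≡ ↥v≡)
          (≡⇒≡-mod (trans (interchange a b (+ suc d₁) (+ suc d₂))
                          (cong ((a * b) *_) (sym (ℤ.pos-* (suc d₁) (suc d₂)))))))
      where interchange : ∀ a b e f → a * e * (b * f) ≡ (a * b) * (e * f)
            interchange = solve-∀

    ≡ᵘ-resp-≃ : ∀ {u v a} → u ≡ᵘ a [mod p ] → u ≃ v → ¬ + p ∣ ↧ᵘ v → v ≡ᵘ a [mod p ]
    ≡ᵘ-resp-≃ {u} {v} {a} (p-integral p∤↧u ↥u≡) (*≡* ↥u↧v≡↥v↧u) p∤↧v = p-integral p∤↧v
      (*-cancelˡ-mod p-prime (↧ᵘ u) p∤↧u
        (≡-mod-trans (≡⇒≡-mod (trans (ℤ.*-comm (↧ᵘ u) (↥ᵘ v)) (sym ↥u↧v≡↥v↧u)))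
          (≡-mod-trans (*-congʳ-mod (↧ᵘ v) ↥u≡) (≡⇒≡-mod (regroup a (↧ᵘ u) (↧ᵘ v))))))
      where regroup : ∀ a b c → a * b * c ≡ b * (a * c)
            regroup = solve-∀

    -- q is in lowest terms, and p ∣ ↧ q would force p ∣ ↥ q as well.
    ≡ᵘ⇒≡ʳ : ∀ q {u a} → toℚᵘ q ≃ u → u ≡ᵘ a [mod p ] → q ≡ʳ a [mod p ]
    ≡ᵘ⇒≡ʳ (mkℚ n d coprime) {u} (*≡* n↧u≡↥u[1+d]) u≡a =
      ≡ᵘ-resp-≃ u≡a (ℚᵘ.≃-sym (*≡* n↧u≡↥u[1+d])) p∤1+d
      where
      p∤1+d : ¬ + p ∣ + suc d
      p∤1+d p∣1+d = ¬prime[1] (subst Prime (recompute coprime (∣⇒∣ᵤ p∣n , ∣⇒∣ᵤ p∣1+d)) p-prime)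
        where
        p∣n : + p ∣ n
        p∣n = prime-∣-cancelˡ p-prime (↧ᵘ u) (p∤↧ u≡a)
                (∣-via-≡ (trans (ℤ.*-comm (↧ᵘ u) n) n↧u≡↥u[1+d]) (ℤ.∣n⇒∣m*n (↥ᵘ u) p∣1+d))

    ≡ʳ-fraction : ∀ z d {a} → mkℚᵘ z d ≡ᵘ a [mod p ] → z / suc d ≡ʳ a [mod p ]
    ≡ʳ-fraction z d = ≡ᵘ⇒≡ʳ (z / suc d) (toℚᵘ-fromℚᵘ (mkℚᵘ z d))

    ≡ʳ-integer : ∀ z → z / 1 ≡ʳ z [mod p ]
    ≡ʳ-integer z = ≡ʳ-fraction z 0 (≡ᵘ-integer z)

    ≡ʳ-+ : ∀ {x y a b} → x ≡ʳ a [mod p ] → y ≡ʳ b [mod p ] → x ℚ.+ y ≡ʳ a + b [mod p ]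
    ≡ʳ-+ {x} {y} x≡a y≡b = ≡ᵘ⇒≡ʳ (x ℚ.+ y) (toℚᵘ-homo-+ x y) (≡ᵘ-+ x≡a y≡b)

    ≡ʳ-* : ∀ {x y a b} → x ≡ʳ a [mod p ] → y ≡ʳ b [mod p ] → x ℚ.* y ≡ʳ a * b [mod p ]
    ≡ʳ-* {x} {y} x≡a y≡b = ≡ᵘ⇒≡ʳ (x ℚ.* y) (toℚᵘ-homo-* x y) (≡ᵘ-* x≡a y≡b)

    ≡ʳ-neg : ∀ {x a} → x ≡ʳ a [mod p ] → ℚ.- x ≡ʳ - a [mod p ]
    ≡ʳ-neg {x} x≡a = ≡ᵘ⇒≡ʳ (ℚ.- x) (toℚᵘ-homo‿- x) (≡ᵘ-neg x≡a)

    ≡ʳ-^ : ∀ {x a} → x ≡ʳ a [mod p ] → ∀ k → x ^ℚ k ≡ʳ a ^ k [mod p ]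
    ≡ʳ-^ x≡a zero    = ≡ʳ-integer 1ℤ
    ≡ʳ-^ x≡a (suc k) = ≡ʳ-* x≡a (≡ʳ-^ x≡a k)

    ≡ʳ-sumℚ : ∀ {f z} → (∀ k → f k ≡ʳ z k [mod p ]) → ∀ m → sumℚ m f ≡ʳ ∑ m z [mod p ]
    ≡ʳ-sumℚ {f} {z} f≡z m = over-applyUpTo (λ k → k) m
      where
      over-applyUpTo : ∀ g m → foldr (λ k acc → f k ℚ.+ acc) 0ℚ (applyUpTo g m) ≡ʳ ∑ m (z ∘ g) [mod p ]
      over-applyUpTo g zero    = ≡ʳ-integer 0ℤ
      over-applyUpTo g (suc m) = ≡ʳ-+ (f≡z (g 0)) (over-applyUpTo (g ∘ suc) m)

    ≡ʳ⇒≡-modℚ : ∀ {x y a} → x ≡ʳ a [mod p ] → y ≡ʳ a [mod p ] → x ≡ y [modℚ p ]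
    ≡ʳ⇒≡-modℚ {x} {y} {a} x≡a y≡a = p∤↧ₙ x≡a , p∤↧ₙ y≡a , p∣↥[x-y]
      where
      p∤↧ₙ : ∀ {q} → q ≡ʳ a [mod p ] → ¬ + p ∣ + ℚ.↧ₙ q
      p∤↧ₙ {q} q≡a = p∤↧ q≡a ∘ ∣-via-≡ (↧ᵘ-toℚᵘ q)
      x-y≡0 : x ℚ.- y ≡ʳ 0ℤ [mod p ]
      x-y≡0 = ≡ᵘ-resp-≡-mod (≡ʳ-+ x≡a (≡ʳ-neg y≡a)) (≡⇒≡-mod (ℤ.+-inverseʳ a))
      p∣↥[x-y] : + p ∣ ℚ.↥ (x ℚ.- y)
      p∣↥[x-y] = ∣-via-≡ (sym (↥ᵘ-toℚᵘ (x ℚ.- y)))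
                   (≡0-mod⇒∣ (≡-mod-trans (↥≡z↧ x-y≡0)
                                          (≡⇒≡-mod (ℤ.*-zeroˡ (↧ᵘ (toℚᵘ (x ℚ.- y)))))))

  module _ {n : ℕ} (p-prime : Prime (suc (n ℕ.+ n))) where

    private
      p : ℕ
      p = suc (n ℕ.+ n)
      p∤2 : ¬ + p ∣ + 2
      p∤2 = odd-prime-∤2 {n} p-prime

    x/2≡-n*x : ∀ x → x / 2 ≡ʳ - + n * x [mod p ]
    x/2≡-n*x x = ≡ʳ-fraction p-prime x 1 (p-integral p∤2
      (≡-mod-trans (inverse-of-2 n x) (≡⇒≡-mod (rearrange (- + n) x))))
      where rearrange : ∀ c x → c * (+ 2 * x) ≡ c * x * + 2
            rearrange = solve-∀

    -1/4≡-n² : -[1+ 0 ] / 4 ≡ʳ - (+ n * + n) [mod p ]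
    -1/4≡-n² = ≡ʳ-fraction p-prime -[1+ 0 ] 3 (p-integral (prime-∤-* p-prime p∤2 p∤2)
      (from-∣ (∣-via-≡ (trans (identity (+ n)) (cong (_* (+ 2 * + n - 1ℤ)) (sym (+[1+n+n]≡1+n+n n))))
                       (ℤ.∣m⇒∣m*n _ ℤ.∣-refl))))
      where identity : ∀ n → -1ℤ - - (n * n) * + 4 ≡ (1ℤ + (n + n)) * (+ 2 * n - 1ℤ)
            identity = solve-∀

    summand≡ : ∀ k → legendre (+ k) 3 / 1 ℚ.* (+ ((2 ℕ.* k) C k) / 1) ℚ.* (-[1+ 0 ] / 4) ^ℚ k
                     ≡ʳ legendre (+ k) 3 * + ((2 ℕ.* k) C k) * (- (+ n * + n)) ^ k [mod p ]
    summand≡ k = ≡ʳ-* p-prime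
      (≡ʳ-* p-prime (≡ʳ-integer p-prime (legendre (+ k) 3)) (≡ʳ-integer p-prime (+ ((2 ℕ.* k) C k))))
      (≡ʳ-^ p-prime -1/4≡-n² k)

open import Defs
open import Data.Nat using (ℕ; _*_)
open import Relation.Binary.PropositionalEquality using (_≢_)
open import Data.Nat.Primality using (Prime)
open import Data.Nat.Combinatorics using (_C_)
open import Data.Integer using (ℤ; +_; -[1+_]; _-_)
open import Data.Rational using (ℚ; _/_) renaming (_*_ to _*ℚ_)

open import Data.Integer as ℤ using (-_; _^_)
open import Data.Product using (_,_)
open import Relation.Binary.PropositionalEquality using (refl)

corollary1p7 : (p : ℕ) → Prime p → p ≢ 2 →
    sumℚ p (λ k → ℤ→ℚ (legendre (+ k) 3) *ℚ ℤ→ℚ (+ ((2 * k) C k)) *ℚ ((-[1+ 0 ] / 4) ^ℚ k))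
      ≡ ((legendre -[1+ 0 ] p - legendre (+ 3) p) / 2) [modℚ p ]
corollary1p7 p p-prime p≢2 with prime≢2⇒odd p-prime p≢2
... | n , refl = ≡ʳ⇒≡-modℚ p-prime
  (≡ᵘ-resp-≡-mod (≡ʳ-sumℚ p-prime (summand≡ {n} p-prime) p) integer-sum≡)
  (x/2≡-n*x {n} p-prime (legendre -[1+ 0 ] p - legendre (+ 3) p))
  where
  open ≡-mod-Reasoning p
  χ : ℕ → ℤ
  χ k = legendre (+ k) 3
  integer-sum≡ : ∑ p (λ k → χ k ℤ.* + ((2 * k) C k) ℤ.* (- (+ n ℤ.* + n)) ^ k)
                   ≡ - + n ℤ.* (legendre -[1+ 0 ] p - legendre (+ 3) p) [mod p ]
  integer-sum≡ = begin
    ∑ p (λ k → χ k ℤ.* + ((2 * k) C k) ℤ.* (- (+ n ℤ.* + n)) ^ k)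
      ≈⟨ central-binomial-sum {n} p-prime χ ⟩
    binomialSum χ n
      ≈⟨ inverse-of-2 n (binomialSum χ n) ⟩
    - + n ℤ.* (+ 2 ℤ.* binomialSum χ n)
      ≈⟨ *-congˡ-mod (- + n) (twice-binomialSum-legendre-3 {n} p-prime) ⟩
    - + n ℤ.* (legendre -[1+ 0 ] p - legendre (+ 3) p) ∎
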